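{- Let $G$ be a finite group. The proper order supergraph $\mathcal{S}^*(G)$ is the line graph of some graph if and only if either $G\cong\mathbb{Z}_6$ or $G$ is an EPPO-group.
   Context: For a finite group $G$ with identity $e$, the order supergraph $\mathcal{S}(G)$ is the simple undirected graph with vertex set $G$ in which distinct $x,y$ are adjacent if and only if $o(x)\mid o(y)$ or $o(y)\mid o(x)$, where $o(x)$ is the order of $x$. $\mathcal{S}^*(G)$ is the subgraph of $\mathcal{S}(G)$ induced by $G\setminus\{e\}$. An EPPO-group is a finite group in which every element has prime power order. A graph is a line graph if it is isomorphic to the line graph $L(\Gamma)$ of some simple graph $\Gamma$ (vertices of $L(\Gamma)$ are the edges of $\Gamma$, adjacent when they share an endpoint); the graph with empty vertex set is regarded as a line graph. -}

module Defs where

open import Data.Nat using (ℕ; zero; suc; _<_; _≤_; _^_; _%_)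
open import Data.Nat.Divisibility using (_∣_)
open import Data.Nat.Primality using (Prime)
open import Data.Fin using (Fin; toℕ; fromℕ<)
open import Data.Fin.Properties using (_≟_)
open import Data.Nat.DivMod using (m%n<n)
open import Data.Bool using (Bool; T; not)
open import Data.Product using (Σ; ∃; _×_; _,_; proj₁; proj₂)
open import Data.Sum using (_⊎_)
open import Relation.Binary.PropositionalEquality using (_≡_; _≢_)
open import Relation.Nullary using (¬_)
open import Relation.Nullary.Decidable using (⌊_⌋)
open import Function.Bundles using (_⤖_; _⇔_; Bijection)

-- Finite groups, presented (up to isomorphism) on the carrier Fin n.
-- Every finite group is isomorphic to one of this form.

record FinGroup : Set where
  field
    n     : ℕ
    _·_   : Fin n → Fin n → Fin n
    e     : Fin n
    inv   : Fin n → Fin n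
    assoc : ∀ x y z → (x · y) · z ≡ x · (y · z)
    idˡ   : ∀ x → e · x ≡ x
    idʳ   : ∀ x → x · e ≡ x
    invˡ  : ∀ x → inv x · x ≡ e
    invʳ  : ∀ x → x · inv x ≡ e

module _ (G : FinGroup) where
  open FinGroup G

  pow : Fin n → ℕ → Fin n
  pow x zero    = e
  pow x (suc k) = x · pow x k

  IsOrder : Fin n → ℕ → Set
  IsOrder x k = 1 ≤ k × pow x k ≡ e × (∀ j → 1 ≤ j → j < k → pow x j ≢ e)

  OrdDiv : Fin n → Fin n → Set
  OrdDiv x y = ∃ λ k → ∃ λ l → IsOrder x k × IsOrder y l × k ∣ l

  EPPO : Set
  EPPO = ∀ x → ∃ λ p → ∃ λ a → Prime p × IsOrder x (p ^ a)

record Graph : Set₁ where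
  field
    V   : Set
    Adj : V → V → Set

ProperOrderSupergraph : FinGroup → Graph
ProperOrderSupergraph G = record
  { V   = Σ (Fin n) (λ x → T (not ⌊ x ≟ e ⌋))
  ; Adj = λ x y → proj₁ x ≢ proj₁ y × (OrdDiv G (proj₁ x) (proj₁ y) ⊎ OrdDiv G (proj₁ y) (proj₁ x))
  }
  where open FinGroup G

record SimpleGraph (m : ℕ) : Set where
  field
    E     : Fin m → Fin m → Bool
    sym   : ∀ u v → E u v ≡ E v u
    irref : ∀ u → E u u ≡ Data.Bool.false

-- Edges {u,v} of Γ, represented by u < v.
Edge : ∀ {m} → SimpleGraph m → Set
Edge {m} Γ = Σ (Fin m) λ u → Σ (Fin m) λ v → toℕ u < toℕ v × T (SimpleGraph.E Γ u v)

LineAdj : ∀ {m} (Γ : SimpleGraph m) → Edge Γ → Edge Γ → Set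
LineAdj Γ (u , v , _) (u' , v' , _) =
  ¬ (u ≡ u' × v ≡ v') × (u ≡ u' ⊎ u ≡ v' ⊎ v ≡ u' ⊎ v ≡ v')

IsLineGraph : Graph → Set
IsLineGraph H = ∃ λ m → ∃ λ (Γ : SimpleGraph m) → Σ (V ⤖ Edge Γ) λ f →
  ∀ x y → Adj x y ⇔ LineAdj Γ (Bijection.to f x) (Bijection.to f y)
  where open Graph H

_+₆_ : Fin 6 → Fin 6 → Fin 6
a +₆ b = fromℕ< (m%n<n (toℕ a Data.Nat.+ toℕ b) 6)

IsoZ6 : FinGroup → Set
IsoZ6 G = Σ (Fin n ⤖ Fin 6) λ φ →
  ∀ x y → Bijection.to φ (x · y) ≡ Bijection.to φ x +₆ Bijection.to φ y
  where open FinGroup G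

{-# OPTIONS --safe #-}
-- If G is an EPPO-group,
-- comparability of orders is an equivalence relation on G ∖ {e} (comparable
-- orders are powers of one prime), so S*(G) is a disjoint union of cliques,
-- the line graph of a disjoint union of stars; S*(ℤ₆) is the line graph of a
-- triangle with two pendant edges at one corner.
--
-- Conversely, in a line graph no three pairwise meeting edges can all meet two
-- disjoint edges (K₅ minus an edge is not a line graph).  An element x of order
-- ab, with a, b ≠ 1 coprime, produces this configuration unless ab = 6: x^b and
-- x^a have the incomparable orders a and b, and x, x^(ab-1), x^(a+b) are three
-- distinct elements of order ab.  So every order is a prime power or 6.  Given
-- x of order 6 and y ∉ ⟨x⟩, two more configurations of edges (a diamond and a
-- triangle) exclude o(y) = 2 and o(y) = 2^k with k ≥ 2; if o(y) is odd, y
-- normalises {x, x⁵} and hence commutes with x³, and x³y is a third element of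
-- order 6.  Hence G = ⟨x⟩ ≅ ℤ₆.
module Submission where

open import Defs
open import Level using (0ℓ)
open import Algebra.Bundles using (Group)
import Algebra.Properties.Group as GroupProperties
open import Data.Nat as ℕ
  using (ℕ; zero; suc; _+_; _*_; _∸_; _≤_; _<_; _≤?_; _<?_; z≤n; s≤s; NonZero; >-nonZero; >-nonZero⁻¹;
         ≢-nonZero⁻¹; _%_; _/_)
open import Data.Nat.Properties
open import Data.Nat.Divisibility
open import Data.Nat.DivMod using (m≡m%n+[m/n]*n; m%n<n)
open import Data.Nat.Coprimality using (Coprime; coprime-divisor; coprime-+; 1-coprimeTo)
  renaming (sym to coprime-sym)
open import Data.Nat.Primality
  using (Prime; euclidsLemma; prime⇒irreducible; prime[2]; prime⇒nonTrivial; prime?)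
open import Data.Nat.Primality.Factorisation using (factorise)
open import Data.Nat.ListAction using (product)
open import Data.Nat.Induction using (<-rec)
open import Data.Nat.Tactic.RingSolver using (solve-∀)
open import Data.Fin using (Fin; zero; suc; toℕ; fromℕ<; #_; _↑ˡ_; _↑ʳ_; splitAt)
open import Data.Fin.Properties
  using (pigeonhole; any?; all?; toℕ-injective; toℕ-fromℕ<; toℕ<n; toℕ-↑ˡ; toℕ-↑ʳ; ↑ˡ-injective; ↑ʳ-injective;
         splitAt-↑ˡ; splitAt-↑ʳ; splitAt⁻¹-↑ˡ; splitAt⁻¹-↑ʳ)
  renaming (_≟_ to _≟ᶠ_)
open import Data.Bool using (Bool; true; false; T; not; _∧_; _∨_)
open import Data.Bool.Properties using (T-irrelevant; T-∧; ∨-comm) renaming (_≟_ to _≟ᵇ_)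
open import Data.Maybe as Maybe using (Maybe; just; nothing; fromMaybe)
open import Data.Maybe.Properties using (just-injective)
open import Data.List using ([]; _∷_)
open import Data.List.Relation.Unary.All using (_∷_)
open import Data.Vec using ([]; _∷_; lookup)
open import Data.Product using (Σ; ∃; ∃₂; _×_; _,_; proj₁; proj₂)
open import Data.Product.Function.NonDependent.Propositional using (_×-⇔_)
open import Data.Sum as Sum using (_⊎_; inj₁; inj₂; [_,_]′)
open import Data.Empty using (⊥; ⊥-elim)
open import Function using (_∘_)
open import Function.Bundles using (_⇔_; mk⇔; Equivalence; Bijection; _⤖_; mk⤖)
import Function.Properties.Equivalence as ⇔
open import Relation.Nullary using (¬_; Dec; yes; no)
open import Relation.Nullary.Decidable
  using (True; False; ⌊_⌋; map′; toWitness; fromWitness; toWitnessFalse; fromWitnessFalse; from-yes; from-no;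
         isYes≗does; does-⇔; ¬?; T?; _×-dec_; _⊎-dec_; _→-dec_)
open import Relation.Unary using () renaming (Decidable to Decidable₁)
open import Relation.Binary using (Decidable; tri<; tri≈; tri>)
open import Relation.Binary.PropositionalEquality

module Arithmetic where
  open import Data.Nat using (_^_)

  Comparable : ℕ → ℕ → Set
  Comparable k l = k ∣ l ⊎ l ∣ k

  comparable? : Decidable Comparable
  comparable? k l = k ∣? l ⊎-dec l ∣? k

  PrimePower : ℕ → Set
  PrimePower k = ∃₂ λ p a → Prime p × k ≡ p ^ a

  CoprimeSplit : ℕ → Set
  CoprimeSplit k = ∃₂ λ a b → a ≢ 1 × b ≢ 1 × Coprime a b × k ≡ a * b

  prime≢1 : ∀ {p} → Prime p → p ≢ 1
  prime≢1 p-prime = ℕ.nonTrivial⇒≢1 ⦃ prime⇒nonTrivial p-prime ⦄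

  prime∣^⇒∣ : ∀ {q p} k → Prime q → q ∣ p ^ k → q ∣ p
  prime∣^⇒∣ zero    q-prime q∣1 = ⊥-elim (prime≢1 q-prime (∣1⇒≡1 q∣1))
  prime∣^⇒∣ {p = p} (suc k) q-prime q∣p^1+k with euclidsLemma p (p ^ k) q-prime q∣p^1+k
  ... | inj₁ q∣p   = q∣p
  ... | inj₂ q∣p^k = prime∣^⇒∣ k q-prime q∣p^k

  prime∣prime⇒≡ : ∀ {q p} → Prime q → Prime p → q ∣ p → q ≡ p
  prime∣prime⇒≡ q-prime p-prime q∣p with prime⇒irreducible p-prime q∣p
  ... | inj₁ q≡1 = ⊥-elim (prime≢1 q-prime q≡1)
  ... | inj₂ q≡p = q≡p

  prime∤⇒coprime : ∀ {p c} → Prime p → ¬ p ∣ c → Coprime p c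
  prime∤⇒coprime p-prime p∤c (d∣p , d∣c) with prime⇒irreducible p-prime d∣p
  ... | inj₁ d≡1  = d≡1
  ... | inj₂ refl = ⊥-elim (p∤c d∣c)

  prime^suc≢1 : ∀ {p} a → Prime p → p ^ suc a ≢ 1
  prime^suc≢1 {p} a p-prime p^1+a≡1 = prime≢1 p-prime (∣1⇒≡1 (subst (p ∣_) p^1+a≡1 (m∣m*n (p ^ a))))

  prime-power-∣⇒same-prime : ∀ {p q} a b → Prime p → Prime q → p ^ suc a ∣ q ^ b → p ≡ q
  prime-power-∣⇒same-prime {p} a b p-prime q-prime p^1+a∣q^b =
    prime∣prime⇒≡ p-prime q-prime (prime∣^⇒∣ b p-prime (∣-trans (m∣m*n (p ^ a)) p^1+a∣q^b))

  comparable-prime-powers⇒same-prime : ∀ {p q} a b → Prime p → Prime q →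
                                       Comparable (p ^ suc a) (q ^ suc b) → p ≡ q
  comparable-prime-powers⇒same-prime a b p-prime q-prime (inj₁ ∣) =
    prime-power-∣⇒same-prime a (suc b) p-prime q-prime ∣
  comparable-prime-powers⇒same-prime a b p-prime q-prime (inj₂ ∣) =
    sym (prime-power-∣⇒same-prime b (suc a) q-prime p-prime ∣)

  ^-monoʳ-∣ : ∀ p {a b} → a ≤ b → p ^ a ∣ p ^ b
  ^-monoʳ-∣ p {a} {b} a≤b =
    divides (p ^ (b ∸ a)) (trans (cong (p ^_) (sym (m∸n+n≡m a≤b))) (^-distribˡ-+-* p (b ∸ a) a))

  prime-powers-comparable : ∀ p a b → Comparable (p ^ a) (p ^ b)
  prime-powers-comparable p a b with ≤-total a b
  ... | inj₁ a≤b = inj₁ (^-monoʳ-∣ p a≤b)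
  ... | inj₂ b≤a = inj₂ (^-monoʳ-∣ p b≤a)

  coprime-*ʳ : ∀ {k a b} → Coprime k a → Coprime k b → Coprime k (a * b)
  coprime-*ʳ {a = a} k⊥a k⊥b {d} (d∣k , d∣ab) = k⊥b (d∣k , coprime-divisor d⊥a d∣ab)
    where
    d⊥a : Coprime d a
    d⊥a (d′∣d , d′∣a) = k⊥a (∣-trans d′∣d d∣k , d′∣a)

  coprime-^ˡ : ∀ {p c} a → Coprime p c → Coprime (p ^ a) c
  coprime-^ˡ zero    p⊥c = 1-coprimeTo _
  coprime-^ˡ (suc a) p⊥c = coprime-sym (coprime-*ʳ (coprime-sym p⊥c) (coprime-sym (coprime-^ˡ a p⊥c)))

  coprime-+* : ∀ {a b} → Coprime a b → Coprime (a + b) (a * b)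
  coprime-+* {a} {b} a⊥b =
    coprime-*ʳ (coprime-+ (coprime-sym a⊥b)) (subst (λ s → Coprime s b) (+-comm b a) (coprime-+ a⊥b))

  coprime-pred : ∀ k → Coprime k (suc k)
  coprime-pred k = coprime-sym (subst (λ s → Coprime s k) (+-comm k 1) (coprime-+ (1-coprimeTo k)))

  coprime⇒incomparable : ∀ {a b} → Coprime a b → a ≢ 1 → b ≢ 1 → ¬ Comparable a b
  coprime⇒incomparable a⊥b a≢1 b≢1 (inj₁ a∣b) = a≢1 (a⊥b (∣-refl , a∣b))
  coprime⇒incomparable a⊥b a≢1 b≢1 (inj₂ b∣a) = b≢1 (a⊥b (b∣a , ∣-refl))

  coprime-∣⇒*∣ : ∀ {k l j} → Coprime k l → k ∣ j → l ∣ j → k * l ∣ j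
  coprime-∣⇒*∣ {k} {l} k⊥l (divides c refl) l∣c*k
    with coprime-divisor (coprime-sym k⊥l) (subst (l ∣_) (*-comm c k) l∣c*k)
  ... | divides d refl = divides d (reassociate d l k)
    where
    reassociate : ∀ d l k → d * l * k ≡ d * (k * l)
    reassociate = solve-∀

  prime-divisor : ∀ k → .{{NonZero k}} → k ≢ 1 → ∃ λ p → Prime p × p ∣ k
  prime-divisor k k≢1 with factorise k
  ... | record { factors = [] ; isFactorisation = k≡1 } = ⊥-elim (k≢1 k≡1)
  ... | record { factors = p ∷ ps ; isFactorisation = k≡ ; factorsPrime = p-prime ∷ _ } =
    p , p-prime , subst (p ∣_) (sym k≡) (m∣m*n (product ps))

  factor-out : ∀ {p} → Prime p → ∀ k → .{{NonZero k}} → ∃₂ λ a c → k ≡ p ^ a * c × ¬ p ∣ c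
  factor-out {p} p-prime = <-rec (λ k → .{{NonZero k}} → ∃₂ λ a c → k ≡ p ^ a * c × ¬ p ∣ c) step
    where
    step : ∀ k → (∀ {j} → j < k → .{{NonZero j}} → ∃₂ λ a c → j ≡ p ^ a * c × ¬ p ∣ c) →
           .{{NonZero k}} → ∃₂ λ a c → k ≡ p ^ a * c × ¬ p ∣ c
    step k rec with p ∣? k
    ... | no p∤k = 0 , k , sym (+-identityʳ k) , p∤k
    ... | yes (divides zero k≡0) = ⊥-elim (≢-nonZero⁻¹ k k≡0)
    ... | yes (divides j@(suc _) k≡j*p)
      with rec (subst (j <_) (sym k≡j*p) (m<m*n j p (ℕ.nonTrivial⇒n>1 p ⦃ prime⇒nonTrivial p-prime ⦄)))
    ... | a , c , j≡p^a*c , p∤c = suc a , c , k≡p^1+a*c , p∤c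
      where
      open ≡-Reasoning
      k≡p^1+a*c : k ≡ p ^ suc a * c
      k≡p^1+a*c = begin
        k               ≡⟨ k≡j*p ⟩
        j * p           ≡⟨ cong (_* p) j≡p^a*c ⟩
        p ^ a * c * p   ≡⟨ *-comm (p ^ a * c) p ⟩
        p * (p ^ a * c) ≡⟨ *-assoc p (p ^ a) c ⟨
        p ^ suc a * c   ∎

  primePower⊎coprimeSplit : ∀ k → .{{NonZero k}} → PrimePower k ⊎ CoprimeSplit k
  primePower⊎coprimeSplit 1 = inj₁ (2 , 0 , prime[2] , refl)
  primePower⊎coprimeSplit k@(suc (suc _)) with prime-divisor k (λ ())
  ... | p , p-prime , p∣k with factor-out p-prime k
  ... | zero , c , k≡1*c , p∤c = ⊥-elim (p∤c (subst (p ∣_) (trans k≡1*c (*-identityˡ c)) p∣k))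
  ... | suc a , c , k≡p^a*c , p∤c with c ℕ.≟ 1
  ...   | yes refl = inj₁ (p , suc a , p-prime , trans k≡p^a*c (*-identityʳ _))
  ...   | no c≢1   = inj₂ (p ^ suc a , c , prime^suc≢1 a p-prime , c≢1 ,
                           coprime-^ˡ (suc a) (prime∤⇒coprime p-prime p∤c) , k≡p^a*c)

  coprime-sum<product : ∀ a b → Coprime (2 + a) (2 + b) → (2 + a) * (2 + b) ≢ 6 →
                        suc ((2 + a) + (2 + b)) < (2 + a) * (2 + b)
  coprime-sum<product a b 2+a⊥2+b ≢6 = begin-strict
    suc (A + B)             <⟨ n<1+n (suc (A + B)) ⟩
    2 + (A + B)             ≤⟨ +-monoˡ-≤ (A + B) (2≤excess a b 2+a⊥2+b ≢6) ⟩
    a + b + a * b + (A + B) ≡⟨ expand a b ⟩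
    A * B                   ∎
    where
    open ≤-Reasoning
    A B : ℕ
    A = 2 + a
    B = 2 + b
    expand : ∀ a b → a + b + a * b + ((2 + a) + (2 + b)) ≡ (2 + a) * (2 + b)
    expand = solve-∀
    2≤excess : ∀ a b → Coprime (2 + a) (2 + b) → (2 + a) * (2 + b) ≢ 6 → 2 ≤ a + b + a * b
    2≤excess 0 0 2⊥2 _ with 2⊥2 (∣-refl , ∣-refl)
    ... | ()
    2≤excess 0             1             _ ≢6 = ⊥-elim (≢6 refl)
    2≤excess 1             0             _ ≢6 = ⊥-elim (≢6 refl)
    2≤excess 0             (suc (suc b)) _ _  = s≤s (s≤s z≤n)
    2≤excess 1             (suc b)       _ _  = s≤s (s≤s z≤n)
    2≤excess (suc (suc a)) b             _ _  = s≤s (s≤s z≤n)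

  2^[2+k]≭6 : ∀ k → ¬ Comparable (2 ^ (2 + k)) 6
  2^[2+k]≭6 k (inj₁ 2^[2+k]∣6) =
    from-no (4 ∣? 6) (∣-trans (m∣m*n (2 ^ k)) (subst (_∣ 6) (sym (*-assoc 2 2 (2 ^ k))) 2^[2+k]∣6))
  2^[2+k]≭6 k (inj₂ 6∣2^[2+k]) =
    from-no (3 ∣? 2) (prime∣^⇒∣ (2 + k) (from-yes (prime? 3)) (∣-trans (m∣m*n 2) 6∣2^[2+k]))

open Arithmetic

least-witness : ∀ {P : ℕ → Set} → Decidable₁ P → ∀ N → P N → ∃ λ k → P k × (∀ {j} → j < k → ¬ P j)
least-witness {P} P? = <-rec (λ N → P N → ∃ λ k → P k × (∀ {j} → j < k → ¬ P j)) step
  where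
  step : ∀ N → (∀ {M} → M < N → P M → ∃ λ k → P k × (∀ {j} → j < k → ¬ P j)) →
         P N → ∃ λ k → P k × (∀ {j} → j < k → ¬ P j)
  step N rec pN with anyUpTo? P? N
  ... | yes (M , M<N , pM) = rec M<N pM
  ... | no  none           = N , pN , λ j<N pj → none (_ , j<N , pj)

all⊎any : ∀ {k} {P Q : Fin k → Set} → (∀ i → P i ⊎ Q i) → (∀ i → P i) ⊎ ∃ Q
all⊎any {zero}  P⊎Q = inj₁ λ ()
all⊎any {suc k} P⊎Q with P⊎Q zero | all⊎any (λ i → P⊎Q (suc i))
... | inj₂ q₀ | _            = inj₂ (zero , q₀)
... | inj₁ _  | inj₂ (i , q) = inj₂ (suc i , q)
... | inj₁ p₀ | inj₁ p       = inj₁ λ { zero → p₀ ; (suc i) → p i }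

module GroupTheory (G : FinGroup) where
  open FinGroup G

  group : Group 0ℓ 0ℓ
  group = record
    { Carrier = Fin n ; _≈_ = _≡_ ; _∙_ = _·_ ; ε = e ; _⁻¹ = inv
    ; isGroup = record
      { isMonoid = record
        { isSemigroup = record
          { isMagma = record { isEquivalence = isEquivalence ; ∙-cong = cong₂ _·_ }
          ; assoc = assoc }
        ; identity = idˡ , idʳ }
      ; inverse = invˡ , invʳ
      ; ⁻¹-cong = cong inv } }

  open GroupProperties group public using (∙-cancelˡ; ∙-cancelʳ; inverseʳ-unique; y≈x\\z)

  infixr 30 _^_
  _^_ : Fin n → ℕ → Fin n
  x ^ k = pow G x k

  ^-+ : ∀ x i j → x ^ (i + j) ≡ x ^ i · x ^ j
  ^-+ x zero    j = sym (idˡ _)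
  ^-+ x (suc i) j = trans (cong (x ·_) (^-+ x i j)) (sym (assoc _ _ _))

  e^ : ∀ j → e ^ j ≡ e
  e^ zero    = refl
  e^ (suc j) = trans (idˡ _) (e^ j)

  ^-* : ∀ x i j → x ^ (i * j) ≡ (x ^ i) ^ j
  ^-* x i zero    = cong (x ^_) (*-zeroʳ i)
  ^-* x i (suc j) = begin
    x ^ (i * suc j)       ≡⟨ cong (x ^_) (*-suc i j) ⟩
    x ^ (i + i * j)       ≡⟨ ^-+ x i (i * j) ⟩
    x ^ i · x ^ (i * j)   ≡⟨ cong (x ^ i ·_) (^-* x i j) ⟩
    x ^ i · (x ^ i) ^ j   ∎
    where open ≡-Reasoning

  Commute : Fin n → Fin n → Set
  Commute x y = x · y ≡ y · x

  ^-commute : ∀ {x y} → Commute x y → ∀ i → Commute (x ^ i) y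
  ^-commute {x} {y} xy≡yx zero    = trans (idˡ y) (sym (idʳ y))
  ^-commute {x} {y} xy≡yx (suc i) = begin
    (x · x ^ i) · y   ≡⟨ assoc _ _ _ ⟩
    x · (x ^ i · y)   ≡⟨ cong (x ·_) (^-commute xy≡yx i) ⟩
    x · (y · x ^ i)   ≡⟨ assoc _ _ _ ⟨
    (x · y) · x ^ i   ≡⟨ cong (_· x ^ i) xy≡yx ⟩
    (y · x) · x ^ i   ≡⟨ assoc _ _ _ ⟩
    y · (x · x ^ i)   ∎
    where open ≡-Reasoning

  ·-^ : ∀ {x y} → Commute x y → ∀ j → (x · y) ^ j ≡ x ^ j · y ^ j
  ·-^ {x} {y} xy≡yx zero    = sym (idˡ e)
  ·-^ {x} {y} xy≡yx (suc j) = begin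
    (x · y) · (x · y) ^ j       ≡⟨ cong ((x · y) ·_) (·-^ xy≡yx j) ⟩
    (x · y) · (x ^ j · y ^ j)   ≡⟨ assoc _ _ _ ⟩
    x · (y · (x ^ j · y ^ j))   ≡⟨ cong (x ·_) (assoc _ _ _) ⟨
    x · ((y · x ^ j) · y ^ j)   ≡⟨ cong (λ z → x · (z · y ^ j)) (^-commute xy≡yx j) ⟨
    x · ((x ^ j · y) · y ^ j)   ≡⟨ cong (x ·_) (assoc _ _ _) ⟩
    x · (x ^ j · (y · y ^ j))   ≡⟨ assoc _ _ _ ⟨
    (x · x ^ j) · (y · y ^ j)   ∎
    where open ≡-Reasoning

  conj : Fin n → Fin n → Fin n
  conj y x = (y · x) · inv y

  conj-· : ∀ y a b → conj y (a · b) ≡ conj y a · conj y b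
  conj-· y a b = begin
    (y · (a · b)) · inv y                   ≡⟨ cong (λ z → (y · (z · b)) · inv y) (idʳ a) ⟨
    (y · ((a · e) · b)) · inv y             ≡⟨ cong (λ z → (y · ((a · z) · b)) · inv y) (invˡ y) ⟨
    (y · ((a · (inv y · y)) · b)) · inv y   ≡⟨ cong (λ z → (y · (z · b)) · inv y) (assoc _ _ _) ⟨
    (y · (((a · inv y) · y) · b)) · inv y   ≡⟨ cong (λ z → (y · z) · inv y) (assoc _ _ _) ⟩
    (y · ((a · inv y) · (y · b))) · inv y   ≡⟨ cong (_· inv y) (assoc _ _ _) ⟨
    ((y · (a · inv y)) · (y · b)) · inv y   ≡⟨ assoc _ _ _ ⟩
    (y · (a · inv y)) · ((y · b) · inv y)   ≡⟨ cong (_· ((y · b) · inv y)) (assoc _ _ _) ⟨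
    ((y · a) · inv y) · ((y · b) · inv y)   ∎
    where open ≡-Reasoning

  conj-e : ∀ y → conj y e ≡ e
  conj-e y = trans (cong (_· inv y) (idʳ y)) (invʳ y)

  conj-^ : ∀ y x j → conj y (x ^ j) ≡ conj y x ^ j
  conj-^ y x zero    = conj-e y
  conj-^ y x (suc j) = trans (conj-· y x (x ^ j)) (cong (conj y x ·_) (conj-^ y x j))

  conj-injective : ∀ y {a b} → conj y a ≡ conj y b → a ≡ b
  conj-injective y {a} {b} eq = ∙-cancelˡ y a b (∙-cancelʳ (inv y) (y · a) (y · b) eq)

  conj-fixed⇒commute : ∀ y a → conj y a ≡ a → Commute y a
  conj-fixed⇒commute y a ya/y≡a = ∙-cancelʳ (inv y) (y · a) (a · y) (begin
    (y · a) · inv y   ≡⟨ ya/y≡a ⟩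
    a                 ≡⟨ idʳ a ⟨
    a · e             ≡⟨ cong (a ·_) (invʳ y) ⟨
    a · (y · inv y)   ≡⟨ assoc a y (inv y) ⟨
    (a · y) · inv y   ∎)
    where open ≡-Reasoning

  ^-∣ : ∀ {x k} → x ^ k ≡ e → ∀ {j} → k ∣ j → x ^ j ≡ e
  ^-∣ {x} {k} x^k≡e (divides q refl) = begin
    x ^ (q * k)   ≡⟨ cong (x ^_) (*-comm q k) ⟩
    x ^ (k * q)   ≡⟨ ^-* x k q ⟩
    (x ^ k) ^ q   ≡⟨ cong (_^ q) x^k≡e ⟩
    e ^ q         ≡⟨ e^ q ⟩
    e             ∎
    where open ≡-Reasoning

  ^-mod : ∀ {x k} .{{_ : NonZero k}} → x ^ k ≡ e → ∀ j → x ^ j ≡ x ^ (j % k)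
  ^-mod {x} {k} x^k≡e j = begin
    x ^ j                           ≡⟨ cong (x ^_) (m≡m%n+[m/n]*n j k) ⟩
    x ^ (j % k + j / k * k)         ≡⟨ ^-+ x (j % k) (j / k * k) ⟩
    x ^ (j % k) · x ^ (j / k * k)   ≡⟨ cong (x ^ (j % k) ·_) (^-∣ x^k≡e (n∣m*n (j / k))) ⟩
    x ^ (j % k) · e                 ≡⟨ idʳ _ ⟩
    x ^ (j % k)                     ∎
    where open ≡-Reasoning

  ^-≡⇒^-∸≡e : ∀ x {i j} → i ≤ j → x ^ i ≡ x ^ j → x ^ (j ∸ i) ≡ e
  ^-≡⇒^-∸≡e x {i} {j} i≤j x^i≡x^j = sym (∙-cancelˡ (x ^ i) e (x ^ (j ∸ i)) (begin
    x ^ i · e             ≡⟨ idʳ _ ⟩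
    x ^ i                 ≡⟨ x^i≡x^j ⟩
    x ^ j                 ≡⟨ cong (x ^_) (m+[n∸m]≡n i≤j) ⟨
    x ^ (i + (j ∸ i))     ≡⟨ ^-+ x i (j ∸ i) ⟩
    x ^ i · x ^ (j ∸ i)   ∎))
    where open ≡-Reasoning

  order-∣ : ∀ {x k} → IsOrder G x k → ∀ {j} → x ^ j ≡ e → k ∣ j
  order-∣ {x} {k@(suc _)} (_ , x^k≡e , minimal) {j} x^j≡e with j % k in j%k≡r
  ... | zero  = m%n≡0⇒n∣m j k j%k≡r
  ... | suc r = ⊥-elim (minimal (suc r) (s≤s z≤n) (subst (_< k) j%k≡r (m%n<n j k))
                  (trans (cong (x ^_) (sym j%k≡r)) (trans (sym (^-mod x^k≡e j)) x^j≡e)))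

  mkIsOrder : ∀ {x k} → 1 ≤ k → x ^ k ≡ e → (∀ {j} → x ^ j ≡ e → k ∣ j) → IsOrder G x k
  mkIsOrder 1≤k x^k≡e k∣ = 1≤k , x^k≡e , λ j 1≤j j<k x^j≡e → <⇒≱ j<k (∣⇒≤ ⦃ >-nonZero 1≤j ⦄ (k∣ x^j≡e))

  order-unique : ∀ {x k l} → IsOrder G x k → IsOrder G x l → k ≡ l
  order-unique x∶k x∶l = ∣-antisym (order-∣ x∶k (proj₁ (proj₂ x∶l))) (order-∣ x∶l (proj₁ (proj₂ x∶k)))

  order-exists : ∀ x → ∃ (IsOrder G x)
  order-exists x with pigeonhole (n<1+n n) (λ (i : Fin (suc n)) → x ^ toℕ i)
  ... | i , j , i<j , x^i≡x^j
    with least-witness (λ k → (1 ≤? k) ×-dec (x ^ k ≟ᶠ e)) (toℕ j ∸ toℕ i)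
           (m<n⇒0<n∸m i<j , ^-≡⇒^-∸≡e x (<⇒≤ i<j) x^i≡x^j)
  ... | k , (1≤k , x^k≡e) , least = k , 1≤k , x^k≡e , λ j 1≤j j<k x^j≡e → least j<k (1≤j , x^j≡e)

  ord : Fin n → ℕ
  ord x = proj₁ (order-exists x)

  ord-isOrder : ∀ x → IsOrder G x (ord x)
  ord-isOrder x = proj₂ (order-exists x)

  isOrder⇒ord≡ : ∀ {x k} → IsOrder G x k → ord x ≡ k
  isOrder⇒ord≡ = order-unique (ord-isOrder _)

  order-e : IsOrder G e 1
  order-e = mkIsOrder (s≤s z≤n) (idˡ e) (λ _ → 1∣ _)

  order≢1⇒≢e : ∀ {x k} → IsOrder G x k → k ≢ 1 → x ≢ e
  order≢1⇒≢e x∶k k≢1 refl = k≢1 (order-unique x∶k order-e)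

  order-^-∣ : ∀ {x} a b → IsOrder G x (a * b) → IsOrder G (x ^ b) a
  order-^-∣ {x} a zero x∶a*0 = ⊥-elim (<⇒≱ (proj₁ x∶a*0) (≤-reflexive (*-zeroʳ a)))
  order-^-∣ {x} a b@(suc _) x∶ab@(1≤ab , x^ab≡e , _) = mkIsOrder 1≤a x^b^a≡e a∣
    where
    1≤a : 1 ≤ a
    1≤a = >-nonZero⁻¹ a ⦃ m*n≢0⇒m≢0 a ⦃ >-nonZero 1≤ab ⦄ ⦄
    x^b^a≡e : (x ^ b) ^ a ≡ e
    x^b^a≡e = trans (sym (^-* x b a)) (trans (cong (x ^_) (*-comm b a)) x^ab≡e)
    a∣ : ∀ {j} → (x ^ b) ^ j ≡ e → a ∣ j
    a∣ {j} x^b^j≡e = *-cancelˡ-∣ b (subst (_∣ b * j) (*-comm a b) (order-∣ x∶ab (trans (^-* x b j) x^b^j≡e)))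

  order-^-coprime : ∀ {x m} k → IsOrder G x m → Coprime k m → IsOrder G (x ^ k) m
  order-^-coprime {x} {m} k x∶m@(1≤m , x^m≡e , _) k⊥m = mkIsOrder 1≤m x^k^m≡e m∣
    where
    x^k^m≡e : (x ^ k) ^ m ≡ e
    x^k^m≡e = trans (sym (^-* x k m)) (^-∣ x^m≡e (n∣m*n k))
    m∣ : ∀ {j} → (x ^ k) ^ j ≡ e → m ∣ j
    m∣ {j} x^k^j≡e = coprime-divisor (coprime-sym k⊥m) (order-∣ x∶m (trans (^-* x k j) x^k^j≡e))

  order-conj : ∀ {x k} y → IsOrder G x k → IsOrder G (conj y x) k
  order-conj {x} {k} y x∶k@(1≤k , x^k≡e , _) = mkIsOrder 1≤k conj^k≡e k∣
    where
    conj^k≡e : conj y x ^ k ≡ e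
    conj^k≡e = trans (sym (conj-^ y x k)) (trans (cong (conj y) x^k≡e) (conj-e y))
    k∣ : ∀ {j} → conj y x ^ j ≡ e → k ∣ j
    k∣ {j} conj^j≡e = order-∣ x∶k (conj-injective y (trans (conj-^ y x j) (trans conj^j≡e (sym (conj-e y)))))

  ^-distinct-below-order : ∀ {x m i j} → IsOrder G x m → i < j → j < m → x ^ i ≢ x ^ j
  ^-distinct-below-order {x} {m} {i} {j} x∶m i<j j<m x^i≡x^j = <⇒≱ (≤-<-trans (m∸n≤m j i) j<m)
    (∣⇒≤ ⦃ >-nonZero (m<n⇒0<n∸m i<j) ⦄ (order-∣ x∶m (^-≡⇒^-∸≡e x (<⇒≤ i<j) x^i≡x^j)))

  ^-injective : ∀ {x m i j} → IsOrder G x m → i < m → j < m → x ^ i ≡ x ^ j → i ≡ j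
  ^-injective {i = i} {j} x∶m i<m j<m x^i≡x^j with <-cmp i j
  ... | tri≈ _ i≡j _ = i≡j
  ... | tri< i<j _ _ = ⊥-elim (^-distinct-below-order x∶m i<j j<m x^i≡x^j)
  ... | tri> _ _ j<i = ⊥-elim (^-distinct-below-order x∶m j<i i<m (sym x^i≡x^j))

  order-·-coprime : ∀ {a b k l} → Commute a b → IsOrder G a k → IsOrder G b l → Coprime k l →
                    IsOrder G (a · b) (k * l)
  order-·-coprime {a} {b} {k} {l} ab≡ba a∶k@(1≤k , a^k≡e , _) b∶l@(1≤l , b^l≡e , _) k⊥l =
    mkIsOrder (*-mono-≤ 1≤k 1≤l) ab^kl≡e kl∣
    where
    open ≡-Reasoning
    ab^kl≡e : (a · b) ^ (k * l) ≡ e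
    ab^kl≡e = begin
      (a · b) ^ (k * l)            ≡⟨ ·-^ ab≡ba (k * l) ⟩
      a ^ (k * l) · b ^ (k * l)    ≡⟨ cong₂ _·_ (^-∣ {a} {k} a^k≡e (m∣m*n l)) (^-∣ {b} {l} b^l≡e (n∣m*n k)) ⟩
      e · e                        ≡⟨ idˡ e ⟩
      e                            ∎
    kl∣ : ∀ {j} → (a · b) ^ j ≡ e → k * l ∣ j
    kl∣ {j} ab^j≡e = coprime-∣⇒*∣ k⊥l k∣j l∣j
      where
      a^jl≡e : a ^ (j * l) ≡ e
      a^jl≡e = begin
        a ^ (j * l)                 ≡⟨ idʳ _ ⟨
        a ^ (j * l) · e             ≡⟨ cong (a ^ (j * l) ·_) (^-∣ {b} {l} b^l≡e (n∣m*n j)) ⟨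
        a ^ (j * l) · b ^ (j * l)   ≡⟨ ·-^ ab≡ba (j * l) ⟨
        (a · b) ^ (j * l)           ≡⟨ ^-* (a · b) j l ⟩
        ((a · b) ^ j) ^ l           ≡⟨ cong (_^ l) ab^j≡e ⟩
        e ^ l                       ≡⟨ e^ l ⟩
        e                           ∎
      k∣j : k ∣ j
      k∣j = coprime-divisor k⊥l (subst (k ∣_) (*-comm j l) (order-∣ a∶k a^jl≡e))
      b^j≡e : b ^ j ≡ e
      b^j≡e = begin
        b ^ j             ≡⟨ idˡ _ ⟨
        e · b ^ j         ≡⟨ cong (_· b ^ j) (^-∣ {a} {k} a^k≡e k∣j) ⟨
        a ^ j · b ^ j     ≡⟨ ·-^ ab≡ba j ⟨
        (a · b) ^ j       ≡⟨ ab^j≡e ⟩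
        e                 ∎
      l∣j : l ∣ j
      l∣j = order-∣ b∶l b^j≡e

  order-1⇒≡e : ∀ {x} → IsOrder G x 1 → x ≡ e
  order-1⇒≡e (_ , x·e≡e , _) = trans (sym (idʳ _)) x·e≡e

  OrdComparable : Fin n → Fin n → Set
  OrdComparable g h = OrdDiv G g h ⊎ OrdDiv G h g

  ordDiv⇔∣ : ∀ {g h k l} → IsOrder G g k → IsOrder G h l → OrdDiv G g h ⇔ k ∣ l
  ordDiv⇔∣ g∶k h∶l = mk⇔
    (λ (_ , _ , g∶k′ , h∶l′ , k′∣l′) → subst₂ _∣_ (order-unique g∶k′ g∶k) (order-unique h∶l′ h∶l) k′∣l′)
    (λ k∣l → _ , _ , g∶k , h∶l , k∣l)

  ordComparable⇔ : ∀ {g h k l} → IsOrder G g k → IsOrder G h l → OrdComparable g h ⇔ Comparable k l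
  ordComparable⇔ g∶k h∶l = mk⇔
    (Sum.map (Equivalence.to (ordDiv⇔∣ g∶k h∶l)) (Equivalence.to (ordDiv⇔∣ h∶l g∶k)))
    (Sum.map (Equivalence.from (ordDiv⇔∣ g∶k h∶l)) (Equivalence.from (ordDiv⇔∣ h∶l g∶k)))

module EdgeGeometry {m} (Γ : SimpleGraph m) where

  infix 4 _∈ₑ_
  _∈ₑ_ : Fin m → Edge Γ → Set
  x ∈ₑ (u , v , _) = x ≡ u ⊎ x ≡ v

  record Meet (A B : Edge Γ) : Set where
    constructor meet
    field
      point : Fin m
      ∈₁    : point ∈ₑ A
      ∈₂    : point ∈ₑ B

  meet-sym : ∀ {A B} → Meet A B → Meet B A
  meet-sym (meet x x∈A x∈B) = meet x x∈B x∈A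

  edge-≡ : ∀ (A B : Edge Γ) → proj₁ A ≡ proj₁ B → proj₁ (proj₂ A) ≡ proj₁ (proj₂ B) → A ≡ B
  edge-≡ (u , v , u<v , uv∈Γ) (.u , .v , u<v′ , uv∈Γ′) refl refl =
    cong₂ (λ p q → u , v , p , q) (≤-irrelevant u<v u<v′) (T-irrelevant uv∈Γ uv∈Γ′)

  lineAdj⇒meet : ∀ A B → LineAdj Γ A B → Meet A B
  lineAdj⇒meet (u , v , _) B (_ , inj₁ u≡u′)               = meet u (inj₁ refl) (inj₁ u≡u′)
  lineAdj⇒meet (u , v , _) B (_ , inj₂ (inj₁ u≡v′))        = meet u (inj₁ refl) (inj₂ u≡v′)
  lineAdj⇒meet (u , v , _) B (_ , inj₂ (inj₂ (inj₁ v≡u′))) = meet v (inj₂ refl) (inj₁ v≡u′)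
  lineAdj⇒meet (u , v , _) B (_ , inj₂ (inj₂ (inj₂ v≡v′))) = meet v (inj₂ refl) (inj₂ v≡v′)

  meet⇒lineAdj : ∀ A B → A ≢ B → Meet A B → LineAdj Γ A B
  meet⇒lineAdj A@(u , v , _) B@(u′ , v′ , _) A≢B (meet x x∈A x∈B) =
    (λ (u≡u′ , v≡v′) → A≢B (edge-≡ A B u≡u′ v≡v′)) , shared x∈A x∈B
    where
    shared : ∀ {x} → x ≡ u ⊎ x ≡ v → x ≡ u′ ⊎ x ≡ v′ → u ≡ u′ ⊎ u ≡ v′ ⊎ v ≡ u′ ⊎ v ≡ v′
    shared (inj₁ refl) (inj₁ refl) = inj₁ refl
    shared (inj₁ refl) (inj₂ refl) = inj₂ (inj₁ refl)
    shared (inj₂ refl) (inj₁ refl) = inj₂ (inj₂ (inj₁ refl))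
    shared (inj₂ refl) (inj₂ refl) = inj₂ (inj₂ (inj₂ refl))

  two-endpoints-determine-edge : ∀ {x y} A B → x ≢ y → x ∈ₑ A → y ∈ₑ A → x ∈ₑ B → y ∈ₑ B → A ≡ B
  two-endpoints-determine-edge A B x≢y (inj₁ refl) (inj₁ refl) _ _ = ⊥-elim (x≢y refl)
  two-endpoints-determine-edge A B x≢y (inj₂ refl) (inj₂ refl) _ _ = ⊥-elim (x≢y refl)
  two-endpoints-determine-edge A B x≢y _ _ (inj₁ refl) (inj₁ refl) = ⊥-elim (x≢y refl)
  two-endpoints-determine-edge A B x≢y _ _ (inj₂ refl) (inj₂ refl) = ⊥-elim (x≢y refl)
  two-endpoints-determine-edge A B _ (inj₁ refl) (inj₂ refl) (inj₁ refl) (inj₂ refl) = edge-≡ A B refl refl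
  two-endpoints-determine-edge A B _ (inj₂ refl) (inj₁ refl) (inj₂ refl) (inj₁ refl) = edge-≡ A B refl refl
  two-endpoints-determine-edge (_ , _ , u<v , _) (_ , _ , u′<v′ , _) _
                               (inj₁ refl) (inj₂ refl) (inj₂ refl) (inj₁ refl) = ⊥-elim (<-asym u<v u′<v′)
  two-endpoints-determine-edge (_ , _ , u<v , _) (_ , _ , u′<v′ , _) _
                               (inj₂ refl) (inj₁ refl) (inj₁ refl) (inj₂ refl) = ⊥-elim (<-asym u<v u′<v′)

  endpoint-is-one-of : ∀ {x y z} C → x ≢ y → x ∈ₑ C → y ∈ₑ C → z ∈ₑ C → z ≡ x ⊎ z ≡ y
  endpoint-is-one-of C x≢y (inj₁ refl) (inj₁ refl) _           = ⊥-elim (x≢y refl)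
  endpoint-is-one-of C x≢y (inj₂ refl) (inj₂ refl) _           = ⊥-elim (x≢y refl)
  endpoint-is-one-of C _   (inj₁ refl) (inj₂ refl) (inj₁ refl) = inj₁ refl
  endpoint-is-one-of C _   (inj₁ refl) (inj₂ refl) (inj₂ refl) = inj₂ refl
  endpoint-is-one-of C _   (inj₂ refl) (inj₁ refl) (inj₁ refl) = inj₂ refl
  endpoint-is-one-of C _   (inj₂ refl) (inj₁ refl) (inj₂ refl) = inj₁ refl

  common-endpoint-unique : ∀ {w s} {X X′} → X ≢ X′ → w ∈ₑ X → w ∈ₑ X′ → s ∈ₑ X → s ∈ₑ X′ → s ≡ w
  common-endpoint-unique {w} {s} {X} {X′} X≢X′ w∈X w∈X′ s∈X s∈X′ with s ≟ᶠ w
  ... | yes s≡w = s≡w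
  ... | no  s≢w = ⊥-elim (X≢X′ (two-endpoints-determine-edge X X′ s≢w s∈X w∈X s∈X′ w∈X′))

  record Crossing (A B C : Edge Γ) : Set where
    field
      left     : Fin m
      right    : Fin m
      left∈A   : left ∈ₑ A
      left∈C   : left ∈ₑ C
      right∈B  : right ∈ₑ B
      right∈C  : right ∈ₑ C
  open Crossing

  crossing : ∀ {A B C} → Meet C A → Meet C B → Crossing A B C
  crossing (meet x x∈C x∈A) (meet y y∈C y∈B) = record
    { left = x ; right = y ; left∈A = x∈A ; left∈C = x∈C ; right∈B = y∈B ; right∈C = y∈C }

  flip : ∀ {A B C} → Crossing A B C → Crossing B A C
  flip c = record
    { left = right c ; right = left c
    ; left∈A = right∈B c ; left∈C = right∈C c ; right∈B = left∈A c ; right∈C = left∈C c }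

  SharesAnEnd : ∀ {A B C D} → Crossing A B C → Crossing A B D → Set
  SharesAnEnd c d = left c ≡ left d ⊎ right c ≡ right d

  module _ {A B} (A∩B=∅ : ¬ Meet A B) where

    crossing-ends-distinct : ∀ {C} (c : Crossing A B C) → left c ≢ right c
    crossing-ends-distinct c refl = A∩B=∅ (meet (left c) (left∈A c) (right∈B c))

    crossing-endpoint : ∀ {C z} (c : Crossing A B C) → z ∈ₑ C → z ≡ left c ⊎ z ≡ right c
    crossing-endpoint {C} c = endpoint-is-one-of C (crossing-ends-distinct c) (left∈C c) (right∈C c)

    meeting-crossings-share-an-end : ∀ {C D} (c : Crossing A B C) (d : Crossing A B D) →
                                     Meet C D → SharesAnEnd c d
    meeting-crossings-share-an-end c d (meet z z∈C z∈D) with crossing-endpoint c z∈C | crossing-endpoint d z∈D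
    ... | inj₁ z≡lc | inj₁ z≡ld = inj₁ (trans (sym z≡lc) z≡ld)
    ... | inj₂ z≡rc | inj₂ z≡rd = inj₂ (trans (sym z≡rc) z≡rd)
    ... | inj₁ refl | inj₂ refl = ⊥-elim (A∩B=∅ (meet z (left∈A c) (right∈B d)))
    ... | inj₂ refl | inj₁ refl = ⊥-elim (A∩B=∅ (meet z (left∈A d) (right∈B c)))

    crossings-with-same-ends : ∀ {C D} (c : Crossing A B C) (d : Crossing A B D) →
                               left c ≡ left d → right c ≡ right d → C ≡ D
    crossings-with-same-ends {C} {D} c d refl refl =
      two-endpoints-determine-edge C D (crossing-ends-distinct c) (left∈C c) (right∈C c) (left∈C d) (right∈C d)

  -- Each Cᵢ joins a point of A to a point of B, and two distinct ones meet iff they share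
  -- exactly one of these points; no three edges of the 4-cycle between A and B do so pairwise.
  K₅-minus-edge-free : ∀ {A B C₁ C₂ C₃} → ¬ Meet A B →
    C₁ ≢ C₂ → C₁ ≢ C₃ → C₂ ≢ C₃ → Meet C₁ C₂ → Meet C₁ C₃ → Meet C₂ C₃ →
    Meet C₁ A → Meet C₁ B → Meet C₂ A → Meet C₂ B → Meet C₃ A → Meet C₃ B → ⊥
  K₅-minus-edge-free {A} {B} {C₁} {C₂} {C₃} A∩B=∅ C₁≢C₂ C₁≢C₃ C₂≢C₃ C₁C₂ C₁C₃ C₂C₃ C₁A C₁B C₂A C₂B C₃A C₃B =
    cases (share C₁C₂ c₁ c₂) (share C₁C₃ c₁ c₃) (share C₂C₃ c₂ c₃)
    where
    c₁ : Crossing A B C₁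
    c₁ = crossing C₁A C₁B
    c₂ : Crossing A B C₂
    c₂ = crossing C₂A C₂B
    c₃ : Crossing A B C₃
    c₃ = crossing C₃A C₃B
    share : ∀ {C D} → Meet C D → (c : Crossing A B C) (d : Crossing A B D) → SharesAnEnd c d
    share CD c d = meeting-crossings-share-an-end A∩B=∅ c d CD
    rights-differ : ∀ {C D} → C ≢ D → (c : Crossing A B C) (d : Crossing A B D) →
                    left c ≡ left d → right c ≢ right d
    rights-differ C≢D c d l r = C≢D (crossings-with-same-ends A∩B=∅ c d l r)
    lefts-differ : ∀ {C D} → C ≢ D → (c : Crossing A B C) (d : Crossing A B D) →
                   right c ≡ right d → left c ≢ left d
    lefts-differ C≢D c d r l = C≢D (crossings-with-same-ends A∩B=∅ c d l r)
    cases : SharesAnEnd c₁ c₂ → SharesAnEnd c₁ c₃ → SharesAnEnd c₂ c₃ → ⊥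
    cases (inj₁ l₁₂) (inj₁ l₁₃) (inj₁ l₂₃)
      with endpoint-is-one-of B (rights-differ C₁≢C₂ c₁ c₂ l₁₂) (right∈B c₁) (right∈B c₂) (right∈B c₃)
    ... | inj₁ r₃≡r₁ = rights-differ C₁≢C₃ c₁ c₃ l₁₃ (sym r₃≡r₁)
    ... | inj₂ r₃≡r₂ = rights-differ C₂≢C₃ c₂ c₃ l₂₃ (sym r₃≡r₂)
    cases (inj₁ l₁₂) (inj₁ l₁₃) (inj₂ r₂₃) = rights-differ C₂≢C₃ c₂ c₃ (trans (sym l₁₂) l₁₃) r₂₃
    cases (inj₁ l₁₂) (inj₂ r₁₃) (inj₁ l₂₃) = rights-differ C₁≢C₃ c₁ c₃ (trans l₁₂ l₂₃) r₁₃
    cases (inj₁ l₁₂) (inj₂ r₁₃) (inj₂ r₂₃) = rights-differ C₁≢C₂ c₁ c₂ l₁₂ (trans r₁₃ (sym r₂₃))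
    cases (inj₂ r₁₂) (inj₁ l₁₃) (inj₁ l₂₃) = lefts-differ C₁≢C₂ c₁ c₂ r₁₂ (trans l₁₃ (sym l₂₃))
    cases (inj₂ r₁₂) (inj₁ l₁₃) (inj₂ r₂₃) = lefts-differ C₁≢C₃ c₁ c₃ (trans r₁₂ r₂₃) l₁₃
    cases (inj₂ r₁₂) (inj₂ r₁₃) (inj₁ l₂₃) = lefts-differ C₂≢C₃ c₂ c₃ (trans (sym r₁₂) r₁₃) l₂₃
    cases (inj₂ r₁₂) (inj₂ r₁₃) (inj₂ r₂₃)
      with endpoint-is-one-of A (lefts-differ C₁≢C₂ c₁ c₂ r₁₂) (left∈A c₁) (left∈A c₂) (left∈A c₃)
    ... | inj₁ l₃≡l₁ = lefts-differ C₁≢C₃ c₁ c₃ r₁₃ (sym l₃≡l₁)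
    ... | inj₂ l₃≡l₂ = lefts-differ C₂≢C₃ c₂ c₃ r₂₃ (sym l₃≡l₂)

  common-neighbour-off-A : ∀ {A B U₁ U₂} (A∩B=∅ : ¬ Meet A B) (c₁ : Crossing A B U₁) (c₂ : Crossing A B U₂) →
    U₁ ≢ U₂ → left c₁ ≡ left c₂ → ∀ {D} → Meet D U₁ → Meet D U₂ → ¬ Meet D A → D ≡ B
  common-neighbour-off-A {A} {B} A∩B=∅ c₁ c₂ U₁≢U₂ l₁≡l₂ {D} DU₁ DU₂ D∩A=∅ =
    two-endpoints-determine-edge D B r₁≢r₂ (right∈D c₁ DU₁) (right∈D c₂ DU₂) (right∈B c₁) (right∈B c₂)
    where
    r₁≢r₂ : right c₁ ≢ right c₂
    r₁≢r₂ r₁≡r₂ = U₁≢U₂ (crossings-with-same-ends A∩B=∅ c₁ c₂ l₁≡l₂ r₁≡r₂)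
    right∈D : ∀ {U} (c : Crossing A B U) → Meet D U → right c ∈ₑ D
    right∈D c (meet z z∈D z∈U) with crossing-endpoint A∩B=∅ c z∈U
    ... | inj₁ refl = ⊥-elim (D∩A=∅ (meet z z∈D (left∈A c)))
    ... | inj₂ refl = z∈D

  -- U₁ and U₂ both join A to B and share an endpoint.  If it lies in A, an edge meeting U₁ and
  -- U₂ but not A contains their two ends in B, so it is B; symmetrically if it lies in B.
  diamond : ∀ {A B U₁ U₂} → ¬ Meet A B → U₁ ≢ U₂ → Meet U₁ U₂ →
    Meet U₁ A → Meet U₁ B → Meet U₂ A → Meet U₂ B →
    (∀ {D} → Meet D U₁ → Meet D U₂ → ¬ Meet D A → D ≡ B) ⊎
    (∀ {D} → Meet D U₁ → Meet D U₂ → ¬ Meet D B → D ≡ A)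
  diamond A∩B=∅ U₁≢U₂ U₁U₂ U₁A U₁B U₂A U₂B
    with meeting-crossings-share-an-end A∩B=∅ (crossing U₁A U₁B) (crossing U₂A U₂B) U₁U₂
  ... | inj₁ l₁≡l₂ = inj₁ (common-neighbour-off-A A∩B=∅ (crossing U₁A U₁B) (crossing U₂A U₂B) U₁≢U₂ l₁≡l₂)
  ... | inj₂ r₁≡r₂ = inj₂ (common-neighbour-off-A (λ BA → A∩B=∅ (meet-sym BA))
                            (flip (crossing U₁A U₁B)) (flip (crossing U₂A U₂B)) U₁≢U₂ r₁≡r₂)

  meeting-all-three-sides : ∀ {X X′ T w p q} → X ≢ X′ → w ∈ₑ X → w ∈ₑ X′ →
    p ∈ₑ T → p ∈ₑ X → q ∈ₑ T → q ∈ₑ X′ → p ≢ w → ∀ {Y} → Meet Y T → Meet Y X ⊎ Meet Y X′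
  meeting-all-three-sides {X} {X′} {T} X≢X′ w∈X w∈X′ p∈T p∈X q∈T q∈X′ p≢w (meet r r∈Y r∈T)
    with endpoint-is-one-of T p≢q p∈T q∈T r∈T
    where p≢q = λ { refl → p≢w (common-endpoint-unique X≢X′ w∈X w∈X′ p∈X q∈X′) }
  ... | inj₁ refl = inj₁ (meet _ r∈Y p∈X)
  ... | inj₂ refl = inj₂ (meet _ r∈Y q∈X′)

  through-common-endpoint : ∀ {X X′ T w} → X ≢ X′ → w ∈ₑ X → w ∈ₑ X′ → w ∈ₑ T → ∀ {S S′} →
    Meet S X → Meet S X′ → ¬ Meet S T → Meet S′ X → Meet S′ X′ → ¬ Meet S′ T → S ≡ S′
  through-common-endpoint {X} {X′} {T} {w} X≢X′ w∈X w∈X′ w∈T {S} {S′}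
    (meet s s∈S s∈X) (meet s′ s′∈S s′∈X′) S∩T=∅ (meet t t∈S′ t∈X) (meet t′ t′∈S′ t′∈X′) S′∩T=∅ =
    two-endpoints-determine-edge S S′ s≢s′ s∈S s′∈S (subst (_∈ₑ S′) t≡s t∈S′) (subst (_∈ₑ S′) t′≡s′ t′∈S′)
    where
    off-w : ∀ {Z z} → ¬ Meet Z T → z ∈ₑ Z → z ≢ w
    off-w Z∩T=∅ z∈Z refl = Z∩T=∅ (meet _ z∈Z w∈T)
    s≢s′ : s ≢ s′
    s≢s′ refl = off-w S∩T=∅ s∈S (common-endpoint-unique X≢X′ w∈X w∈X′ s∈X s′∈X′)
    other-end : ∀ Z {a b} → w ∈ₑ Z → a ∈ₑ Z → b ∈ₑ Z → a ≢ w → b ≢ w → b ≡ a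
    other-end Z w∈Z a∈Z b∈Z a≢w b≢w with endpoint-is-one-of Z (λ w≡a → a≢w (sym w≡a)) w∈Z a∈Z b∈Z
    ... | inj₁ b≡w = ⊥-elim (b≢w b≡w)
    ... | inj₂ b≡a = b≡a
    t≡s : t ≡ s
    t≡s = other-end X w∈X s∈X t∈X (off-w S∩T=∅ s∈S) (off-w S′∩T=∅ t∈S′)
    t′≡s′ : t′ ≡ s′
    t′≡s′ = other-end X′ w∈X′ s′∈X′ t′∈X′ (off-w S∩T=∅ s′∈S) (off-w S′∩T=∅ t′∈S′)

  -- Either T passes through the common endpoint of X and X′ (and every S meeting X and X′ but
  -- not T joins their other ends), or X, X′, T form a triangle.
  triangle : ∀ {X X′ T} → X ≢ X′ → Meet X X′ → Meet T X → Meet T X′ →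
    (∀ {Y} → Meet Y T → Meet Y X ⊎ Meet Y X′) ⊎
    (∀ {S S′} → Meet S X → Meet S X′ → ¬ Meet S T → Meet S′ X → Meet S′ X′ → ¬ Meet S′ T → S ≡ S′)
  triangle X≢X′ (meet w w∈X w∈X′) (meet p p∈T p∈X) (meet q q∈T q∈X′) with p ≟ᶠ w | q ≟ᶠ w
  ... | yes refl | _        = inj₂ (through-common-endpoint X≢X′ w∈X w∈X′ p∈T)
  ... | no _     | yes refl = inj₂ (through-common-endpoint X≢X′ w∈X w∈X′ q∈T)
  ... | no p≢w   | no _     = inj₁ (meeting-all-three-sides X≢X′ w∈X w∈X′ p∈T p∈X q∈T q∈X′ p≢w)

lineAdj? : ∀ {m} (Γ : SimpleGraph m) (A B : Edge Γ) → Dec (LineAdj Γ A B)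
lineAdj? Γ (u , v , _) (u′ , v′ , _) =
  ¬? ((u ≟ᶠ u′) ×-dec (v ≟ᶠ v′)) ×-dec ((u ≟ᶠ u′) ⊎-dec (u ≟ᶠ v′) ⊎-dec (v ≟ᶠ u′) ⊎-dec (v ≟ᶠ v′))

first : ∀ {k} → (Fin k → Bool) → Maybe (Fin k)
first {zero}  p = nothing
first {suc k} p with p zero
... | true  = just zero
... | false = Maybe.map suc (first (p ∘ suc))

first-just : ∀ {k} (p : Fin k → Bool) i → T (p i) → ∃ λ j → first p ≡ just j × T (p j)
first-just {suc k} p i pi with p zero in p0≡
... | true = zero , refl , subst T (sym p0≡) _
first-just {suc k} p zero    pi | false = ⊥-elim (subst T p0≡ pi)
first-just {suc k} p (suc i) pi | false with first-just (p ∘ suc) i pi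
... | j , first≡j , pj = suc j , cong (Maybe.map suc) first≡j , pj

first-cong : ∀ {k} (p q : Fin k → Bool) → (∀ i → p i ≡ q i) → first p ≡ first q
first-cong {zero}  p q p≗q = refl
first-cong {suc k} p q p≗q with p zero | q zero | p≗q zero
... | true  | true  | _ = refl
... | false | false | _ = cong (Maybe.map suc) (first-cong (p ∘ suc) (q ∘ suc) (p≗q ∘ suc))

module ClassRepresentatives {n} (member : Fin n → Bool) {R : Fin n → Fin n → Set} (R? : Decidable R)
  (R-refl : ∀ {g} → T (member g) → R g g)
  (R-sym : ∀ {g h} → R g h → R h g)
  (R-trans : ∀ {g h k} → T (member g) → T (member h) → T (member k) → R g h → R h k → R g k)
  where

  classmateᵇ : Fin n → Fin n → Bool
  classmateᵇ g h = member h ∧ ⌊ R? g h ⌋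

  rep : Fin n → Fin n
  rep g = fromMaybe g (first (classmateᵇ g))

  rep-spec : ∀ g → T (member g) → first (classmateᵇ g) ≡ just (rep g) × T (member (rep g)) × R g (rep g)
  rep-spec g g∈ with first-just (classmateᵇ g) g (Equivalence.from T-∧ (g∈ , fromWitness (R-refl g∈)))
  ... | j , first≡j , j-classmate rewrite first≡j with Equivalence.to T-∧ j-classmate
  ... | j∈ , gRj = refl , j∈ , toWitness gRj

  classmates-agree : ∀ {g h} → T (member g) → T (member h) → R g h → ∀ k → classmateᵇ g k ≡ classmateᵇ h k
  classmates-agree {g} {h} g∈ h∈ gRh k with member k in k∈≡
  ... | false = refl
  ... | true  =
    trans (isYes≗does (R? g k)) (trans (does-⇔ gRk⇔hRk (R? g k) (R? h k)) (sym (isYes≗does (R? h k))))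
    where
    k∈ : T (member k)
    k∈ = subst T (sym k∈≡) _
    gRk⇔hRk : R g k ⇔ R h k
    gRk⇔hRk = mk⇔ (R-trans h∈ g∈ k∈ (R-sym gRh)) (R-trans g∈ h∈ k∈ gRh)

  R⇔rep≡ : ∀ g h → T (member g) → T (member h) → R g h ⇔ rep g ≡ rep h
  R⇔rep≡ g h g∈ h∈ with rep-spec g g∈ | rep-spec h h∈
  ... | first≡rep-g , rep-g∈ , gR | first≡rep-h , rep-h∈ , hR = mk⇔ to from
    where
    to : R g h → rep g ≡ rep h
    to gRh = just-injective
      (trans (sym first≡rep-g) (trans (first-cong _ _ (classmates-agree g∈ h∈ gRh)) first≡rep-h))
    from : rep g ≡ rep h → R g h
    from rep≡ = R-trans g∈ rep-g∈ h∈ gR (R-sym (subst (R h) (sym rep≡) hR))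

module StarForest {n} (member : Fin n → Bool) (rep : Fin n → Fin n) where

  Member : Fin n → Set
  Member g = T (member g)

  hub leaf : Fin n → Fin (n + n)
  hub a  = a ↑ˡ n
  leaf g = n ↑ʳ g

  hub<leaf : ∀ a g → toℕ (hub a) < toℕ (leaf g)
  hub<leaf a g = subst₂ _<_ (sym (toℕ-↑ˡ a n)) (sym (toℕ-↑ʳ n g)) (≤-trans (toℕ<n a) (m≤m+n n (toℕ g)))

  spokeᵇ : Fin n → Fin n → Bool
  spokeᵇ a g = member g ∧ ⌊ a ≟ᶠ rep g ⌋

  adjacentᵇ : Fin n ⊎ Fin n → Fin n ⊎ Fin n → Bool
  adjacentᵇ (inj₁ a) (inj₂ g) = spokeᵇ a g
  adjacentᵇ (inj₂ g) (inj₁ a) = spokeᵇ a g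
  adjacentᵇ (inj₁ _) (inj₁ _) = false
  adjacentᵇ (inj₂ _) (inj₂ _) = false

  forest : SimpleGraph (n + n)
  forest = record
    { E     = λ u v → adjacentᵇ (splitAt n u) (splitAt n v)
    ; sym   = λ u v → adjacentᵇ-sym (splitAt n u) (splitAt n v)
    ; irref = λ u → adjacentᵇ-irrefl (splitAt n u)
    }
    where
    adjacentᵇ-sym : ∀ x y → adjacentᵇ x y ≡ adjacentᵇ y x
    adjacentᵇ-sym (inj₁ _) (inj₁ _) = refl
    adjacentᵇ-sym (inj₁ _) (inj₂ _) = refl
    adjacentᵇ-sym (inj₂ _) (inj₁ _) = refl
    adjacentᵇ-sym (inj₂ _) (inj₂ _) = refl
    adjacentᵇ-irrefl : ∀ x → adjacentᵇ x x ≡ false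
    adjacentᵇ-irrefl (inj₁ _) = refl
    adjacentᵇ-irrefl (inj₂ _) = refl

  open EdgeGeometry forest using (edge-≡)

  spoke : Σ (Fin n) Member → Edge forest
  spoke (g , g∈) = hub (rep g) , leaf g , hub<leaf (rep g) g , spoke∈forest
    where
    spoke∈forest : T (adjacentᵇ (splitAt n (hub (rep g))) (splitAt n (leaf g)))
    spoke∈forest rewrite splitAt-↑ˡ n (rep g) n | splitAt-↑ʳ n n g =
      Equivalence.from T-∧ (g∈ , fromWitness refl)

  spoke-injective : ∀ {x y} → spoke x ≡ spoke y → x ≡ y
  spoke-injective {g , g∈} {h , h∈} eq with ↑ʳ-injective n g h (cong (proj₁ ∘ proj₂) eq)
  ... | refl = cong (g ,_) (T-irrelevant g∈ h∈)

  every-edge-a-spoke : ∀ u v → toℕ u < toℕ v → ∀ {x y} → splitAt n u ≡ x → splitAt n v ≡ y → T (adjacentᵇ x y) →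
                       ∃ λ g → Member g × hub (rep g) ≡ u × leaf g ≡ v
  every-edge-a-spoke u v _ {inj₁ a} {inj₂ g} u↦a v↦g a—g with Equivalence.to T-∧ a—g
  ... | g∈ , a≡rep = g , g∈ , trans (cong hub (sym (toWitness a≡rep))) (splitAt⁻¹-↑ˡ u↦a) , splitAt⁻¹-↑ʳ v↦g
  every-edge-a-spoke u v u<v {inj₂ g} {inj₁ a} u↦g v↦a _ =
    ⊥-elim (<-asym u<v (subst₂ _<_ (cong toℕ (splitAt⁻¹-↑ˡ v↦a)) (cong toℕ (splitAt⁻¹-↑ʳ u↦g)) (hub<leaf a g)))

  hub≢leaf : ∀ {a g} → hub a ≢ leaf g
  hub≢leaf {a} {g} eq = <⇒≢ (hub<leaf a g) (cong toℕ eq)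

  spokes : Σ (Fin n) Member ⤖ Edge forest
  spokes = mk⤖ {to = spoke} (spoke-injective , surjective)
    where
    surjective : ∀ E → ∃ λ x → ∀ {z} → z ≡ x → spoke z ≡ E
    surjective E@(u , v , u<v , uv∈forest) with every-edge-a-spoke u v u<v refl refl uv∈forest
    ... | g , g∈ , hub≡u , leaf≡v = (g , g∈) , λ { refl → edge-≡ (spoke (g , g∈)) E hub≡u leaf≡v }

  isLineGraph : (R : Fin n → Fin n → Set) → (∀ g h → Member g → Member h → R g h ⇔ rep g ≡ rep h) →
    IsLineGraph (record { V = Σ (Fin n) Member ; Adj = λ x y → proj₁ x ≢ proj₁ y × R (proj₁ x) (proj₁ y) })
  isLineGraph R R⇔rep≡ = n + n , forest , spokes , adjacency
    where
    adjacency : ∀ x y → (proj₁ x ≢ proj₁ y × R (proj₁ x) (proj₁ y)) ⇔ LineAdj forest (spoke x) (spoke y)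
    adjacency (g , g∈) (h , h∈) = mk⇔ to from
      where
      to : g ≢ h × R g h → LineAdj forest (spoke (g , g∈)) (spoke (h , h∈))
      to (g≢h , gRh) = (λ (_ , leaf≡leaf) → g≢h (↑ʳ-injective n g h leaf≡leaf)) ,
                       inj₁ (cong hub (Equivalence.to (R⇔rep≡ g h g∈ h∈) gRh))
      from : LineAdj forest (spoke (g , g∈)) (spoke (h , h∈)) → g ≢ h × R g h
      from (¬same , inj₁ hub≡hub) =
        (λ { refl → ¬same (hub≡hub , refl) }) , Equivalence.from (R⇔rep≡ g h g∈ h∈) (↑ˡ-injective n _ _ hub≡hub)
      from (_ , inj₂ (inj₁ hub≡leaf))        = ⊥-elim (hub≢leaf hub≡leaf)
      from (_ , inj₂ (inj₂ (inj₁ leaf≡hub))) = ⊥-elim (hub≢leaf (sym leaf≡hub))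
      from (¬same , inj₂ (inj₂ (inj₂ leaf≡leaf))) with ↑ʳ-injective n g h leaf≡leaf
      ... | refl = ⊥-elim (¬same (refl , refl))

infixr 8 _×₆_
_×₆_ : ℕ → Fin 6 → Fin 6
zero  ×₆ a = # 0
suc j ×₆ a = a +₆ (j ×₆ a)

order₆ : Fin 6 → ℕ
order₆ a = lookup (1 ∷ 6 ∷ 3 ∷ 2 ∷ 3 ∷ 6 ∷ []) a

order₆-positive : ∀ a → 1 ≤ order₆ a
order₆-positive = from-yes (all? λ a → 1 ≤? order₆ a)

order₆-annihilates : ∀ a → order₆ a ×₆ a ≡ # 0
order₆-annihilates = from-yes (all? λ a → order₆ a ×₆ a ≟ᶠ # 0)

order₆-minimal : ∀ a {j} → j < order₆ a → 1 ≤ j → j ×₆ a ≢ # 0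
order₆-minimal = from-yes (all? λ a → allUpTo? (λ j → (1 ≤? j) →-dec ¬? (j ×₆ a ≟ᶠ # 0)) (order₆ a))

idempotent₆ : ∀ a → a ≡ a +₆ a → a ≡ # 0
idempotent₆ = from-yes (all? λ a → (a ≟ᶠ a +₆ a) →-dec (a ≟ᶠ # 0))

edgeᵇ : ℕ → ℕ → Bool
edgeᵇ 0 1 = true
edgeᵇ 0 2 = true
edgeᵇ 1 2 = true
edgeᵇ 0 3 = true
edgeᵇ 0 4 = true
edgeᵇ _ _ = false

E₆ : Fin 5 → Fin 5 → Bool
E₆ u v = edgeᵇ (toℕ u) (toℕ v) ∨ edgeᵇ (toℕ v) (toℕ u)

Γ₆ : SimpleGraph 5
Γ₆ = record
  { E     = E₆
  ; sym   = λ u v → ∨-comm (edgeᵇ (toℕ u) (toℕ v)) (edgeᵇ (toℕ v) (toℕ u))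
  ; irref = from-yes (all? λ u → E₆ u u ≟ᵇ false)
  }

edge₆ : ∀ (u v : Fin 5) {u<v : True (toℕ u <? toℕ v)} {uv : T (E₆ u v)} → Edge Γ₆
edge₆ u v {u<v} {uv} = u , v , toWitness u<v , uv

-- Γ₆ is the triangle 0–1–2 with pendant edges 0–3 and 0–4.  The generators 1 and 5 of ℤ₆ go to
-- the triangle sides at 0, the elements 2 and 4 of order 3 to the pendant edges, and 3 to the side
-- 1–2; the identity 0, which is not a vertex of S*(ℤ₆), gets an arbitrary edge.
encode : Fin 6 → Edge Γ₆
encode = lookup (edge₆ (# 1) (# 2) ∷ edge₆ (# 0) (# 1) ∷ edge₆ (# 0) (# 3) ∷
                 edge₆ (# 1) (# 2) ∷ edge₆ (# 0) (# 4) ∷ edge₆ (# 0) (# 2) ∷ [])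

decodeℕ : ℕ → ℕ → Fin 6
decodeℕ 0 1 = # 1
decodeℕ 0 2 = # 5
decodeℕ 0 3 = # 2
decodeℕ 0 4 = # 4
decodeℕ 1 2 = # 3
decodeℕ _ _ = # 0

decode : Edge Γ₆ → Fin 6
decode (u , v , _) = decodeℕ (toℕ u) (toℕ v)

decode-encode : ∀ a → a ≢ # 0 → decode (encode a) ≡ a
decode-encode a a≢0 = [ (λ a≡0 → ⊥-elim (a≢0 a≡0)) , (λ eq → eq) ]′
  (from-yes (all? λ a → (a ≟ᶠ # 0) ⊎-dec (decode (encode a) ≟ᶠ a)) a)

encode-decode : ∀ E → decode E ≢ # 0 × encode (decode E) ≡ E
encode-decode E@(u , v , u<v , uv) with check u v uv u<v
  where
  check : ∀ u v → T (E₆ u v) → toℕ u < toℕ v →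
          decodeℕ (toℕ u) (toℕ v) ≢ # 0 × proj₁ (encode (decodeℕ (toℕ u) (toℕ v))) ≡ u ×
          proj₁ (proj₂ (encode (decodeℕ (toℕ u) (toℕ v)))) ≡ v
  check = from-yes (all? λ u → all? λ v → T? (E₆ u v) →-dec ((toℕ u <? toℕ v) →-dec
            (¬? (decodeℕ (toℕ u) (toℕ v) ≟ᶠ # 0) ×-dec (proj₁ (encode (decodeℕ (toℕ u) (toℕ v))) ≟ᶠ u) ×-dec
             (proj₁ (proj₂ (encode (decodeℕ (toℕ u) (toℕ v)))) ≟ᶠ v))))
... | decoded≢0 , u≡ , v≡ = decoded≢0 , EdgeGeometry.edge-≡ Γ₆ (encode (decode E)) E u≡ v≡

adjacency₆ : ∀ a b → a ≢ # 0 → b ≢ # 0 →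
             (a ≢ b × Comparable (order₆ a) (order₆ b)) ⇔ LineAdj Γ₆ (encode a) (encode b)
adjacency₆ a b a≢0 b≢0 with check a b
  where
  adjacent? : ∀ a b → Dec (a ≢ b × Comparable (order₆ a) (order₆ b))
  adjacent? a b = ¬? (a ≟ᶠ b) ×-dec comparable? (order₆ a) (order₆ b)
  check : ∀ a b → a ≡ # 0 ⊎ b ≡ # 0 ⊎
          ((a ≢ b × Comparable (order₆ a) (order₆ b) → LineAdj Γ₆ (encode a) (encode b)) ×
           (LineAdj Γ₆ (encode a) (encode b) → a ≢ b × Comparable (order₆ a) (order₆ b)))
  check = from-yes (all? λ a → all? λ b → (a ≟ᶠ # 0) ⊎-dec (b ≟ᶠ # 0) ⊎-dec
            ((adjacent? a b →-dec lineAdj? Γ₆ (encode a) (encode b)) ×-dec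
             (lineAdj? Γ₆ (encode a) (encode b) →-dec adjacent? a b)))
... | inj₁ a≡0               = ⊥-elim (a≢0 a≡0)
... | inj₂ (inj₁ b≡0)        = ⊥-elim (b≢0 b≡0)
... | inj₂ (inj₂ (to , from)) = mk⇔ to from

module CyclicOfOrder6 (G : FinGroup) where
  open FinGroup G
  open GroupTheory G

  module Isomorphic (iso : IsoZ6 G) where

    ψ : Fin n → Fin 6
    ψ = Bijection.to (proj₁ iso)

    ψ-injective : ∀ {g h} → ψ g ≡ ψ h → g ≡ h
    ψ-injective = Bijection.injective (proj₁ iso)

    ψ-e : ψ e ≡ # 0
    ψ-e = idempotent₆ (ψ e) (trans (cong ψ (sym (idˡ e))) (proj₂ iso e e))

    ψ-^ : ∀ g j → ψ (g ^ j) ≡ j ×₆ ψ g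
    ψ-^ g zero    = ψ-e
    ψ-^ g (suc j) = trans (proj₂ iso g (g ^ j)) (cong (ψ g +₆_) (ψ-^ g j))

    order-via-ψ : ∀ g → IsOrder G g (order₆ (ψ g))
    order-via-ψ g = order₆-positive (ψ g) ,
      ψ-injective (trans (ψ-^ g (order₆ (ψ g))) (trans (order₆-annihilates (ψ g)) (sym ψ-e))) ,
      λ j 1≤j j<order g^j≡e →
        order₆-minimal (ψ g) j<order 1≤j (trans (sym (ψ-^ g j)) (trans (cong ψ g^j≡e) ψ-e))

    ψ-nonzero : ∀ {g} → g ≢ e → ψ g ≢ # 0
    ψ-nonzero g≢e ψg≡0 = g≢e (ψ-injective (trans ψg≡0 (sym ψ-e)))

    Vertex : Set
    Vertex = Graph.V (ProperOrderSupergraph G)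

    toEdge : Vertex → Edge Γ₆
    toEdge (g , _) = encode (ψ g)

    toEdge-bijection : Vertex ⤖ Edge Γ₆
    toEdge-bijection = mk⤖ {to = toEdge} (injective , surjective)
      where
      injective : ∀ {x y} → toEdge x ≡ toEdge y → x ≡ y
      injective {g , g≢e} {h , h≢e} same-edge
        with ψ-injective (trans (sym (decode-encode (ψ g) (ψ-nonzero (toWitnessFalse g≢e))))
                         (trans (cong decode same-edge) (decode-encode (ψ h) (ψ-nonzero (toWitnessFalse h≢e)))))
      ... | refl = cong (g ,_) (T-irrelevant g≢e h≢e)
      surjective : ∀ E → ∃ λ x → ∀ {z} → z ≡ x → toEdge z ≡ E
      surjective E with Bijection.surjective (proj₁ iso) (decode E) | encode-decode E
      ... | g , ψg≡ | decoded≢0 , encode-decoded =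
        (g , fromWitnessFalse (λ g≡e → decoded≢0 (trans (sym (ψg≡ refl)) (trans (cong ψ g≡e) ψ-e)))) ,
        λ { refl → trans (cong encode (ψg≡ refl)) encode-decoded }

    adjacency : ∀ x y → Graph.Adj (ProperOrderSupergraph G) x y ⇔ LineAdj Γ₆ (toEdge x) (toEdge y)
    adjacency (g , g≢e) (h , h≢e) =
      ⇔.trans (≢-via-ψ ×-⇔ ordComparable⇔ (order-via-ψ g) (order-via-ψ h))
              (adjacency₆ (ψ g) (ψ h) (ψ-nonzero (toWitnessFalse g≢e)) (ψ-nonzero (toWitnessFalse h≢e)))
      where
      ≢-via-ψ : g ≢ h ⇔ ψ g ≢ ψ h
      ≢-via-ψ = mk⇔ (λ g≢h ψg≡ψh → g≢h (ψ-injective ψg≡ψh)) (λ ψg≢ψh g≡h → ψg≢ψh (cong ψ g≡h))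

    isLineGraph : IsLineGraph (ProperOrderSupergraph G)
    isLineGraph = 5 , Γ₆ , toEdge-bijection , adjacency

  generated-by-order-6⇒≅ℤ₆ : ∀ {x} → IsOrder G x 6 → (∀ y → ∃ λ (i : Fin 6) → y ≡ x ^ toℕ i) → IsoZ6 G
  generated-by-order-6⇒≅ℤ₆ {x} x∶6 powers-of-x = mk⤖ {to = log} (log-injective , log-surjective) , log-hom
    where
    log : Fin n → Fin 6
    log y = proj₁ (powers-of-x y)
    x^log : ∀ y → y ≡ x ^ toℕ (log y)
    x^log y = proj₂ (powers-of-x y)
    log-injective : ∀ {g h} → log g ≡ log h → g ≡ h
    log-injective {g} {h} eq = trans (x^log g) (trans (cong (λ i → x ^ toℕ i) eq) (sym (x^log h)))
    log-surjective : ∀ i → ∃ λ y → ∀ {z} → z ≡ y → log z ≡ i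
    log-surjective i =
      x ^ toℕ i , λ { refl → toℕ-injective (^-injective x∶6 (toℕ<n _) (toℕ<n i) (sym (x^log _))) }
    log-hom : ∀ g h → log (g · h) ≡ log g +₆ log h
    log-hom g h =
      toℕ-injective (trans (^-injective x∶6 (toℕ<n _) (m%n<n s 6) x^log[gh]) (sym (toℕ-fromℕ< (m%n<n s 6))))
      where
      open ≡-Reasoning
      s : ℕ
      s = toℕ (log g) + toℕ (log h)
      x^log[gh] : x ^ toℕ (log (g · h)) ≡ x ^ (s % 6)
      x^log[gh] = begin
        x ^ toℕ (log (g · h))                      ≡⟨ x^log (g · h) ⟨
        g · h                                      ≡⟨ cong₂ _·_ (x^log g) (x^log h) ⟩
        x ^ toℕ (log g) · x ^ toℕ (log h)          ≡⟨ ^-+ x (toℕ (log g)) (toℕ (log h)) ⟨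
        x ^ s                                      ≡⟨ ^-mod {x} {6} (proj₁ (proj₂ x∶6)) s ⟩
        x ^ (s % 6)                                ∎

module EPPOGroup (G : FinGroup) (eppo : EPPO G) where
  open FinGroup G
  open GroupTheory G

  nonidentity : Fin n → Bool
  nonidentity g = not ⌊ g ≟ᶠ e ⌋

  ordComparable⇒ : ∀ {g h} → OrdComparable g h → Comparable (ord g) (ord h)
  ordComparable⇒ = Equivalence.to (ordComparable⇔ (ord-isOrder _) (ord-isOrder _))

  ⇒ordComparable : ∀ {g h} → Comparable (ord g) (ord h) → OrdComparable g h
  ⇒ordComparable = Equivalence.from (ordComparable⇔ (ord-isOrder _) (ord-isOrder _))

  ordComparable? : Decidable OrdComparable
  ordComparable? g h = map′ ⇒ordComparable ordComparable⇒ (comparable? (ord g) (ord h))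

  nontrivial-prime-power-order : ∀ {g} → T (nonidentity g) → ∃₂ λ p a → Prime p × ord g ≡ p ℕ.^ suc a
  nontrivial-prime-power-order {g} g≢e with eppo g
  ... | p , zero  , _       , g∶1        = ⊥-elim (toWitnessFalse g≢e (order-1⇒≡e g∶1))
  ... | p , suc a , p-prime , g∶p^[1+a] = p , a , p-prime , isOrder⇒ord≡ g∶p^[1+a]

  ordComparable-trans : ∀ {g h k} → T (nonidentity g) → T (nonidentity h) → T (nonidentity k) →
                          OrdComparable g h → OrdComparable h k → OrdComparable g k
  ordComparable-trans g≢e h≢e k≢e gRh hRk
    with nontrivial-prime-power-order g≢e | nontrivial-prime-power-order h≢e | nontrivial-prime-power-order k≢e
  ... | p , a , p-prime , ord-g≡ | q , b , q-prime , ord-h≡ | r , c , r-prime , ord-k≡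
    with comparable-prime-powers⇒same-prime a b p-prime q-prime
           (subst₂ Comparable ord-g≡ ord-h≡ (ordComparable⇒ gRh))
       | comparable-prime-powers⇒same-prime b c q-prime r-prime
           (subst₂ Comparable ord-h≡ ord-k≡ (ordComparable⇒ hRk))
  ... | refl | refl =
    ⇒ordComparable (subst₂ Comparable (sym ord-g≡) (sym ord-k≡) (prime-powers-comparable p (suc a) (suc c)))

  open ClassRepresentatives nonidentity ordComparable?
         (λ _ → inj₁ (_ , _ , ord-isOrder _ , ord-isOrder _ , ∣-refl)) [ inj₂ , inj₁ ]′ ordComparable-trans

  isLineGraph : IsLineGraph (ProperOrderSupergraph G)
  isLineGraph = StarForest.isLineGraph nonidentity rep OrdComparable R⇔rep≡

module OrderSupergraphAsLineGraph (G : FinGroup) (isLineGraph : IsLineGraph (ProperOrderSupergraph G)) where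
  open FinGroup G
  open GroupTheory G

  Γ : SimpleGraph (proj₁ isLineGraph)
  Γ = proj₁ (proj₂ isLineGraph)

  open EdgeGeometry Γ

  φ : Graph.V (ProperOrderSupergraph G) ⤖ Edge Γ
  φ = proj₁ (proj₂ (proj₂ isLineGraph))

  φ-adj : ∀ x y → Graph.Adj (ProperOrderSupergraph G) x y ⇔ LineAdj Γ (Bijection.to φ x) (Bijection.to φ y)
  φ-adj = proj₂ (proj₂ (proj₂ isLineGraph))

  record Vertex : Set where
    constructor vertex
    field
      elem     : Fin n
      order    : ℕ
      hasOrder : IsOrder G elem order
      order≢1  : order ≢ 1
  open Vertex

  edge : Vertex → Edge Γ
  edge v = Bijection.to φ (elem v , fromWitnessFalse (order≢1⇒≢e (hasOrder v) (order≢1 v)))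

  edge-injective : ∀ u v → edge u ≡ edge v → elem u ≡ elem v
  edge-injective u v eq = cong proj₁ (Bijection.injective φ eq)

  edges-distinct : ∀ u v → elem u ≢ elem v → edge u ≢ edge v
  edges-distinct u v u≢v eq = u≢v (edge-injective u v eq)

  elems-differ : ∀ u v → order u ≢ order v → elem u ≢ elem v
  elems-differ u v ku≢kv refl = ku≢kv (order-unique (hasOrder u) (hasOrder v))

  edges-meet : ∀ u v → elem u ≢ elem v → Comparable (order u) (order v) → Meet (edge u) (edge v)
  edges-meet u v u≢v u≍v = lineAdj⇒meet (edge u) (edge v)
    (Equivalence.to (φ-adj _ _) (u≢v , Equivalence.from (ordComparable⇔ (hasOrder u) (hasOrder v)) u≍v))

  edges-disjoint : ∀ u v → ¬ Comparable (order u) (order v) → ¬ Meet (edge u) (edge v)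
  edges-disjoint u v u≭v uv = u≭v (Equivalence.to (ordComparable⇔ (hasOrder u) (hasOrder v))
    (proj₂ (Equivalence.from (φ-adj _ _) (meet⇒lineAdj _ _ (edges-distinct u v (elems-differ u v ku≢kv)) uv))))
    where
    ku≢kv : order u ≢ order v
    ku≢kv ku≡kv = u≭v (inj₁ (∣-reflexive ku≡kv))

  no-three-elements-of-order : ∀ (a b : Vertex) {N} → ¬ Comparable (order a) (order b) →
    order a ∣ N → order b ∣ N → ∀ {c₁ c₂ c₃} → IsOrder G c₁ N → IsOrder G c₂ N → IsOrder G c₃ N →
    c₁ ≢ c₂ → c₁ ≢ c₃ → c₂ ≢ c₃ → ⊥
  no-three-elements-of-order a b {N} a≭b a∣N b∣N c₁∶N c₂∶N c₃∶N c₁≢c₂ c₁≢c₃ c₂≢c₃ =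
    K₅-minus-edge-free (edges-disjoint a b a≭b)
      (edges-distinct c₁ c₂ c₁≢c₂) (edges-distinct c₁ c₃ c₁≢c₃) (edges-distinct c₂ c₃ c₂≢c₃)
      (edges-meet c₁ c₂ c₁≢c₂ N≍N) (edges-meet c₁ c₃ c₁≢c₃ N≍N) (edges-meet c₂ c₃ c₂≢c₃ N≍N)
      (above c₁∶N a a≢N a∣N) (above c₁∶N b b≢N b∣N) (above c₂∶N a a≢N a∣N) (above c₂∶N b b≢N b∣N)
      (above c₃∶N a a≢N a∣N) (above c₃∶N b b≢N b∣N)
    where
    N≢1 : N ≢ 1
    N≢1 refl = order≢1 a (∣1⇒≡1 a∣N)
    ofOrderN : ∀ {c} → IsOrder G c N → Vertex
    ofOrderN c∶N = vertex _ N c∶N N≢1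
    c₁ c₂ c₃ : Vertex
    c₁ = ofOrderN c₁∶N
    c₂ = ofOrderN c₂∶N
    c₃ = ofOrderN c₃∶N
    N≍N : Comparable N N
    N≍N = inj₁ ∣-refl
    a≢N : order a ≢ N
    a≢N refl = a≭b (inj₂ b∣N)
    b≢N : order b ≢ N
    b≢N refl = a≭b (inj₁ a∣N)
    above : ∀ {c} (c∶N : IsOrder G c N) u → order u ≢ N → order u ∣ N → Meet (edge (ofOrderN c∶N)) (edge u)
    above c∶N u u≢N u∣N =
      edges-meet (ofOrderN c∶N) u (λ c≡u → elems-differ u (ofOrderN c∶N) u≢N (sym c≡u)) (inj₂ u∣N)

  coprime-split-order≡6 : ∀ {x} a b → IsOrder G x (a * b) → a ≢ 1 → b ≢ 1 → Coprime a b → a * b ≡ 6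
  coprime-split-order≡6 0 b (() , _) _ _ _
  coprime-split-order≡6 1 b _ a≢1 _ _ = ⊥-elim (a≢1 refl)
  coprime-split-order≡6 a@(suc (suc _)) 0 (1≤a*0 , _) _ _ _ = ⊥-elim (<⇒≱ 1≤a*0 (≤-reflexive (*-zeroʳ a)))
  coprime-split-order≡6 a 1 _ _ b≢1 _ = ⊥-elim (b≢1 refl)
  coprime-split-order≡6 {x} a@(suc (suc a′)) b@(suc (suc b′)) x∶ab a≢1 b≢1 a⊥b with a * b ≟ 6
  ... | yes ab≡6 = ab≡6
  ... | no  ab≢6 =
    ⊥-elim (no-three-elements-of-order xᵇ xᵃ (coprime⇒incomparable a⊥b a≢1 b≢1) (m∣m*n b) (n∣m*n a)
      (order-^-coprime 1 x∶ab (1-coprimeTo _))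
      (order-^-coprime (N ∸ 1) x∶ab (coprime-pred (N ∸ 1)))
      (order-^-coprime (a + b) x∶ab (coprime-+* a⊥b))
      (λ eq → <⇒≢ (<-trans 1<a+b a+b<N-1) (^-injective x∶ab 1<N N-1<N eq))
      (λ eq → <⇒≢ 1<a+b (^-injective x∶ab 1<N a+b<N eq))
      (λ eq → <⇒≢ a+b<N-1 (sym (^-injective x∶ab N-1<N a+b<N eq))))
    where
    N : ℕ
    N = a * b
    xᵇ xᵃ : Vertex
    xᵇ = vertex (x ^ b) a (order-^-∣ a b x∶ab) a≢1
    xᵃ = vertex (x ^ a) b (order-^-∣ b a (subst (IsOrder G x) (*-comm a b) x∶ab)) b≢1
    a+b<N-1 : a + b < N ∸ 1
    a+b<N-1 = ≤-pred (coprime-sum<product a′ b′ a⊥b ab≢6)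
    N-1<N : N ∸ 1 < N
    N-1<N = ≤-refl
    a+b<N : a + b < N
    a+b<N = <-trans a+b<N-1 N-1<N
    1<a+b : 1 < a + b
    1<a+b = s≤s (s≤s z≤n)
    1<N : 1 < N
    1<N = <-trans 1<a+b a+b<N

  infix 4 _meets_ _avoids_
  _meets_ : ∀ u v → {False (order u ≟ order v)} → {True (comparable? (order u) (order v))} →
            Meet (edge u) (edge v)
  _meets_ u v {u≢v} {u≍v} = edges-meet u v (elems-differ u v (toWitnessFalse u≢v)) (toWitness u≍v)

  _avoids_ : ∀ u v → {False (comparable? (order u) (order v))} → ¬ Meet (edge u) (edge v)
  _avoids_ u v {u≭v} = edges-disjoint u v (toWitnessFalse u≭v)

  module OfOrder6 {x} (x∶6 : IsOrder G x 6) where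

    x¹ x² x³ x⁴ x⁵ : Vertex
    x¹ = vertex (x ^ 1) 6 (order-^-coprime 1 x∶6 (1-coprimeTo 6)) (λ ())
    x² = vertex (x ^ 2) 3 (order-^-∣ 3 2 x∶6) (λ ())
    x³ = vertex (x ^ 3) 2 (order-^-∣ 2 3 x∶6) (λ ())
    x⁴ = vertex (x ^ 4) 3 (subst (λ g → IsOrder G g 3) (sym (^-* x 2 2))
                            (order-^-coprime 2 (hasOrder x²) (coprime-pred 2))) (λ ())
    x⁵ = vertex (x ^ 5) 6 (order-^-coprime 5 x∶6 (coprime-pred 5)) (λ ())

    x^-mod-6 : ∀ j → x ^ j ≡ x ^ (j ℕ.% 6)
    x^-mod-6 = ^-mod {x} {6} (proj₁ (proj₂ x∶6))

    x¹≢x⁵ : x ^ 1 ≢ x ^ 5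
    x¹≢x⁵ = ^-distinct-below-order x∶6 (from-yes (1 <? 5)) (from-yes (5 <? 6))

    x²≢x⁴ : x ^ 2 ≢ x ^ 4
    x²≢x⁴ = ^-distinct-below-order x∶6 (from-yes (2 <? 4)) (from-yes (4 <? 6))

    x¹-meets-x⁵ : Meet (edge x¹) (edge x⁵)
    x¹-meets-x⁵ = edges-meet x¹ x⁵ x¹≢x⁵ (inj₁ ∣-refl)

    order-6-elements : ∀ {z} → IsOrder G z 6 → z ≡ x ^ 1 ⊎ z ≡ x ^ 5
    order-6-elements {z} z∶6 with z ≟ᶠ x ^ 1 | z ≟ᶠ x ^ 5
    ... | yes z≡x¹ | _        = inj₁ z≡x¹
    ... | no _     | yes z≡x⁵ = inj₂ z≡x⁵
    ... | no z≢x¹  | no z≢x⁵  = ⊥-elim (no-three-elements-of-order x³ x² (from-no (comparable? 2 3))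
                                  (from-yes (2 ∣? 6)) (from-yes (3 ∣? 6)) (hasOrder x¹) (hasOrder x⁵) z∶6
                                  x¹≢x⁵ (λ x¹≡z → z≢x¹ (sym x¹≡z)) (λ x⁵≡z → z≢x⁵ (sym x⁵≡z)))

    module Outside {y} (y∉⟨x⟩ : ∀ j → y ≢ x ^ j) where

      not-of-order-6 : ¬ IsOrder G y 6
      not-of-order-6 y∶6 = [ y∉⟨x⟩ 1 , y∉⟨x⟩ 5 ]′ (order-6-elements y∶6)

      not-of-order-2 : ¬ IsOrder G y 2
      not-of-order-2 y∶2 =
        [ (λ only-x² → x²≢x⁴ (edge-injective x² x⁴ (sym (only-x² (x⁴ meets x¹) (x⁴ meets x⁵) (x⁴ avoids x³)))))
        , (λ only-x³ → y∉⟨x⟩ 3 (edge-injective y′ x³ (only-x³ (y′ meets x¹) (y′ meets x⁵) (y′ avoids x²))))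
        ]′ (diamond (x³ avoids x²) (edges-distinct x¹ x⁵ x¹≢x⁵) x¹-meets-x⁵
                    (x¹ meets x³) (x¹ meets x²) (x⁵ meets x³) (x⁵ meets x²))
        where
        y′ : Vertex
        y′ = vertex y 2 y∶2 (λ ())

      not-of-order-2^[2+k] : ∀ k → ¬ IsOrder G y (2 ℕ.^ (2 + k))
      not-of-order-2^[2+k] k y∶2^[2+k] =
        [ (λ third-side → [ y′-avoids x¹ refl , y′-avoids x⁵ refl ]′ (third-side y′-meets-x³))
        , (λ through-x¹x⁵ → x²≢x⁴ (edge-injective x² x⁴
             (through-x¹x⁵ (x² meets x¹) (x² meets x⁵) (x² avoids x³) (x⁴ meets x¹) (x⁴ meets x⁵) (x⁴ avoids x³))))
        ]′ (triangle (edges-distinct x¹ x⁵ x¹≢x⁵) x¹-meets-x⁵ (x³ meets x¹) (x³ meets x⁵))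
        where
        y′ : Vertex
        y′ = vertex y (2 ℕ.^ (2 + k)) y∶2^[2+k]
               (λ 2^[2+k]≡1 → from-no (2 ∣? 1) (subst (2 ∣_) 2^[2+k]≡1 (m∣m*n (2 ℕ.^ (1 + k)))))
        y′-meets-x³ : Meet (edge y′) (edge x³)
        y′-meets-x³ = edges-meet y′ x³ (λ y≡x³ → y∉⟨x⟩ 3 y≡x³) (inj₂ (m∣m*n (2 ℕ.^ (1 + k))))
        y′-avoids : ∀ v → order v ≡ 6 → ¬ Meet (edge y′) (edge v)
        y′-avoids v refl = edges-disjoint y′ v (2^[2+k]≭6 k)

      x³-self-inverse : x ^ 3 ≡ inv (x ^ 3)
      x³-self-inverse = inverseʳ-unique (x ^ 3) (x ^ 3) (trans (sym (^-+ x 3 3)) (proj₁ (proj₂ x∶6)))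

      commutes-with-x³ : Commute y (x ^ 3)
      commutes-with-x³ = conj-fixed⇒commute y (x ^ 3)
        (trans conj-^³ (cubes (order-6-elements (order-conj y (hasOrder x¹)))))
        where
        conj-^³ : conj y (x ^ 3) ≡ conj y (x ^ 1) ^ 3
        conj-^³ = trans (cong (conj y) (^-* x 1 3)) (conj-^ y (x ^ 1) 3)
        cubes : ∀ {z} → z ≡ x ^ 1 ⊎ z ≡ x ^ 5 → z ^ 3 ≡ x ^ 3
        cubes (inj₁ refl) = sym (^-* x 1 3)
        cubes (inj₂ refl) = trans (sym (^-* x 5 3)) (x^-mod-6 15)

      x³y≡xⁱ⇒y≡x³⁺ⁱ : ∀ i → x ^ 3 · y ≡ x ^ i → y ≡ x ^ (3 + i)
      x³y≡xⁱ⇒y≡x³⁺ⁱ i x³y≡xⁱ = begin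
        y                     ≡⟨ y≈x\\z (x ^ 3) y (x ^ i) x³y≡xⁱ ⟩
        inv (x ^ 3) · x ^ i   ≡⟨ cong (_· x ^ i) x³-self-inverse ⟨
        x ^ 3 · x ^ i         ≡⟨ ^-+ x 3 i ⟨
        x ^ (3 + i)           ∎
        where open ≡-Reasoning

      not-of-odd-order : ∀ {m} → IsOrder G y m → ¬ 2 ∣ m → ⊥
      not-of-odd-order {m} y∶m 2∤m =
        [ (λ x³y≡x¹ → y∉⟨x⟩ 4 (x³y≡xⁱ⇒y≡x³⁺ⁱ 1 x³y≡x¹)) , (λ x³y≡x⁵ → y∉⟨x⟩ 8 (x³y≡xⁱ⇒y≡x³⁺ⁱ 5 x³y≡x⁵)) ]′
          (order-6-elements x³y∶6)
        where
        2⊥m : Coprime 2 m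
        2⊥m = prime∤⇒coprime prime[2] 2∤m
        m≢1 : m ≢ 1
        m≢1 refl = y∉⟨x⟩ 0 (order-1⇒≡e y∶m)
        x³y∶2m : IsOrder G (x ^ 3 · y) (2 * m)
        x³y∶2m = order-·-coprime (sym commutes-with-x³) (hasOrder x³) y∶m 2⊥m
        x³y∶6 : IsOrder G (x ^ 3 · y) 6
        x³y∶6 = subst (IsOrder G _) (coprime-split-order≡6 2 m x³y∶2m (λ ()) m≢1 2⊥m) x³y∶2m

      not-of-order-2^ : ∀ k → ¬ IsOrder G y (2 ℕ.^ k)
      not-of-order-2^ 0             y∶1 = y∉⟨x⟩ 0 (order-1⇒≡e y∶1)
      not-of-order-2^ 1             = not-of-order-2
      not-of-order-2^ (suc (suc k)) = not-of-order-2^[2+k] k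

      not-of-prime-power-order : ∀ {p} k → Prime p → ¬ IsOrder G y (p ℕ.^ k)
      not-of-prime-power-order {p} k p-prime y∶p^k with p ≟ 2
      ... | yes refl = not-of-order-2^ k y∶p^k
      ... | no  p≢2  = not-of-odd-order y∶p^k
                         (λ 2∣p^k → p≢2 (sym (prime∣prime⇒≡ prime[2] p-prime (prime∣^⇒∣ k prime[2] 2∣p^k))))

      impossible : ⊥
      impossible with primePower⊎coprimeSplit (ord y) ⦃ >-nonZero (proj₁ (ord-isOrder y)) ⦄
      ... | inj₁ (p , k , p-prime , ord≡p^k) =
        not-of-prime-power-order k p-prime (subst (IsOrder G y) ord≡p^k (ord-isOrder y))
      ... | inj₂ (a , b , a≢1 , b≢1 , a⊥b , ord≡ab) =
        not-of-order-6 (subst (IsOrder G y) (coprime-split-order≡6 a b y∶ab a≢1 b≢1 a⊥b) y∶ab)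
        where
        y∶ab : IsOrder G y (a * b)
        y∶ab = subst (IsOrder G y) ord≡ab (ord-isOrder y)

    powers-exhaust : ∀ y → ∃ λ (i : Fin 6) → y ≡ x ^ toℕ i
    powers-exhaust y with any? (λ i → y ≟ᶠ x ^ toℕ i)
    ... | yes y∈⟨x⟩ = y∈⟨x⟩
    ... | no  y∉⟨x⟩ = ⊥-elim (Outside.impossible {y} λ j y≡xʲ → y∉⟨x⟩ (fromℕ< (m%n<n j 6) ,
                        trans y≡xʲ (trans (x^-mod-6 j) (cong (x ^_) (sym (toℕ-fromℕ< (m%n<n j 6)))))))

  isoZ6⊎EPPO : IsoZ6 G ⊎ EPPO G
  isoZ6⊎EPPO with all⊎any (λ g → primePower⊎coprimeSplit (ord g) ⦃ >-nonZero (proj₁ (ord-isOrder g)) ⦄)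
  ... | inj₁ prime-power-orders = inj₂ λ g → let (p , a , p-prime , ord≡p^a) = prime-power-orders g
                                             in p , a , p-prime , subst (IsOrder G g) ord≡p^a (ord-isOrder g)
  ... | inj₂ (g , a , b , a≢1 , b≢1 , a⊥b , ord≡ab) =
    inj₁ (CyclicOfOrder6.generated-by-order-6⇒≅ℤ₆ G g∶6 (OfOrder6.powers-exhaust g∶6))
    where
    g∶ab : IsOrder G g (a * b)
    g∶ab = subst (IsOrder G g) ord≡ab (ord-isOrder g)
    g∶6 : IsOrder G g 6
    g∶6 = subst (IsOrder G g) (coprime-split-order≡6 a b g∶ab a≢1 b≢1 a⊥b) g∶ab

mainTheorem4 : (G : FinGroup) →
    IsLineGraph (ProperOrderSupergraph G) ⇔ (IsoZ6 G ⊎ EPPO G)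
mainTheorem4 G = mk⇔ (OrderSupergraphAsLineGraph.isoZ6⊎EPPO G)
  [ CyclicOfOrder6.Isomorphic.isLineGraph G , EPPOGroup.isLineGraph G ]′
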